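{- There is a function $f\colon[0,1]\to[0,1]$ which is Lipschitz, satisfies $f(\mathbb{Q}\cap[0,1])\subseteq\mathbb{Q}$, and is linear-time computable, but is not pointwise linear-time computable.
   Context: For a finite binary string $\sigma$, $\overline{\sigma}=\sum_{s<|\sigma|}\sigma(s)2^{ -s-1}$. A Lipschitz $f\colon[0,1]\to\mathbb{R}$ is linear-time computable if there is $\psi\colon\{0,1\}^{<\omega}\times\mathbb{N}\to\{0,1\}^{<\omega}$ with $|\overline{\psi(\sigma,n)}-f(\overline{\sigma})|<2^{ -n}$ for all $\sigma,n$, such that $\psi(\sigma,n)$ is computable by a multi-tape deterministic Turing machine in $O(|\sigma|+n)$ steps. A Lipschitz $f$ mapping dyadic rationals in $[0,1]$ to rationals is pointwise linear-time computable if there is $\psi\colon\{0,1\}^{<\omega}\to\{0,1\}^{<\omega}\times\{0,1\}^{<\omega}$ computable by a multi-tape deterministic Turing machine in $O(|\sigma|)$ steps such that whenever $\psi(\sigma)=(\tau,\eta)$, the eventually periodic binary sequence $\tau\eta\eta\eta\cdots$ represents exactly $f(\overline{\sigma})$.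
   Formalization: The function f is replaced by its restriction to the rationals in $[0,1]$, a rational-valued map, in place of a function defined on all of $[0,1]$. -}

module Defs where

open import Data.Bool using (Bool; true; false; if_then_else_)
open import Data.Nat as ℕ using (ℕ; zero; suc)
open import Data.Fin using (Fin; zero; suc)
open import Data.Integer as ℤ using (ℤ; +_)
open import Data.List using (List; []; _∷_; _++_; map; length; replicate)
open import Data.Vec as Vec using (Vec)
open import Data.Product using (Σ; ∃; _×_; _,_; proj₁; proj₂)
open import Data.Rational as ℚ using (ℚ; 0ℚ; 1ℚ; ½; ∣_∣)
open import Relation.Binary.PropositionalEquality using (_≡_)
open import Relation.Nullary using (¬_; does)

bit : Bool → ℚ
bit false = 0ℚ
bit true  = 1ℚ

bar : List Bool → ℚ
bar []      = 0ℚ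
bar (b ∷ σ) = ½ ℚ.* (bit b ℚ.+ bar σ)

pow2inv : ℕ → ℚ
pow2inv zero    = 1ℚ
pow2inv (suc n) = ½ ℚ.* pow2inv n

pow2 : ℕ → ℚ
pow2 zero    = 1ℚ
pow2 (suc n) = (1ℚ ℚ.+ 1ℚ) ℚ.* pow2 n

-- The eventually periodic binary sequence τηηη… represents exactly v.
-- If η is empty the sequence is τ000… (value bar τ).  If η is nonempty,
-- Σ_s x(s)2^{-s-1} = bar τ + 2^{-|τ|} · bar η / (1 - 2^{-|η|}), which is
-- stated multiplicatively (1 - 2^{-|η|} ≠ 0), determining v uniquely.
Represents : List Bool → List Bool → ℚ → Set
Represents τ []      v = v ≡ bar τ
Represents τ (e ∷ η) v =
  (v ℚ.- bar τ) ℚ.* pow2 (length τ) ℚ.* (1ℚ ℚ.- pow2inv (length (e ∷ η)))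
    ≡ bar (e ∷ η)

Sym : ℕ → Set
Sym g = Fin (4 ℕ.+ g)

blank : ∀ {g} → Sym g
blank = zero

sep : ∀ {g} → Sym g
sep = suc (suc (suc zero))

encBit : ∀ {g} → Bool → Sym g
encBit false = suc zero
encBit true  = suc (suc zero)

enc : ∀ {g} → List Bool → List (Sym g)
enc = map encBit

data Move : Set where
  left right stay : Move

-- A machine with 2 + k two-way infinite tapes: tape 0 is the input tape,
-- tape 1 the output tape, the remaining k are work tapes.
record TM : Set where
  field
    g k q : ℕ
    start : Fin q
    halting : Fin q → Bool
    δ : Fin q → Vec (Sym g) (2 ℕ.+ k) →
        Fin q × Vec (Sym g) (2 ℕ.+ k) × Vec Move (2 ℕ.+ k)

module _ (M : TM) where
  open TM M

  Tape : Set
  Tape = ℤ → Sym g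

  record Config : Set where
    constructor config
    field
      state : Fin q
      heads : Vec ℤ (2 ℕ.+ k)
      tapes : Vec Tape (2 ℕ.+ k)

  open Config

  write : Tape → ℤ → Sym g → Tape
  write t h a z = if does (z ℤ.≟ h) then a else t z

  move : Move → ℤ → ℤ
  move left  h = h ℤ.- ℤ.1ℤ
  move right h = h ℤ.+ ℤ.1ℤ
  move stay  h = h

  step : Config → Config
  step c with halting (state c)
  ... | true  = c
  ... | false =
    let r = δ (state c) (Vec.zipWith (λ t h → t h) (tapes c) (heads c))
        s′ = proj₁ r ; w = proj₁ (proj₂ r) ; m = proj₂ (proj₂ r)
    in config s′ (Vec.zipWith move m (heads c))
                 (Vec.zipWith (λ t hw → write t (proj₁ hw) (proj₂ hw))
                              (tapes c) (Vec.zip (heads c) w))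

  run : ℕ → Config → Config
  run zero    c = c
  run (suc n) c = run n (step c)

  listTape : List (Sym g) → ℕ → Sym g
  listTape []      _       = blank
  listTape (a ∷ w) zero    = a
  listTape (a ∷ w) (suc n) = listTape w n

  inputTape : List (Sym g) → Tape
  inputTape w (+ n)      = listTape w n
  inputTape w ℤ.-[1+ n ] = blank

  initial : List (Sym g) → Config
  initial w = config start (Vec.replicate _ (+ 0))
                           (inputTape w Vec.∷ Vec.replicate _ (λ _ → blank))

  Holds : Tape → ℤ → List (Sym g) → Set
  Holds t z []      = t z ≡ blank
  Holds t z (a ∷ w) = t z ≡ a × Holds t (z ℤ.+ ℤ.1ℤ) w

  HaltsWithin : List (Sym g) → ℕ → List (Sym g) → Set
  HaltsWithin w T out = Σ ℕ λ t → t ℕ.≤ T ×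
    (halting (state (run t (initial w))) ≡ true ×
     Holds (Vec.lookup (tapes (run t (initial w))) (suc zero)) (+ 0) out)

-- Real-function notions (f is given by its values on ℚ ∩ [0,1])

In01 : ℚ → Set
In01 x = 0ℚ ℚ.≤ x × x ℚ.≤ 1ℚ

MapsUnitToUnit : (ℚ → ℚ) → Set
MapsUnitToUnit f = ∀ x → In01 x → In01 (f x)

LipschitzOn01 : (ℚ → ℚ) → Set
LipschitzOn01 f = ∃ λ (L : ℚ) → ∀ x y → In01 x → In01 y →
  ∣ f x ℚ.- f y ∣ ℚ.≤ L ℚ.* ∣ x ℚ.- y ∣

pairInput : ∀ {g} → List Bool → ℕ → List (Sym g)
pairInput σ n = enc σ ++ (sep ∷ replicate n (encBit true))

LinearTimeComputable : (ℚ → ℚ) → Set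
LinearTimeComputable f = Σ TM λ M → Σ ℕ λ c → ∀ σ n → Σ (List Bool) λ ρ →
  HaltsWithin M (pairInput σ n) (c ℕ.* (length σ ℕ.+ n ℕ.+ 1)) (enc ρ) ×
  ∣ bar ρ ℚ.- f (bar σ) ∣ ℚ.< pow2inv n

PointwiseLinearTimeComputable : (ℚ → ℚ) → Set
PointwiseLinearTimeComputable f = Σ TM λ M → Σ ℕ λ c → ∀ σ →
  Σ (List Bool) λ τ → Σ (List Bool) λ η →
  HaltsWithin M (enc σ) (c ℕ.* (length σ ℕ.+ 1)) (enc τ ++ (sep ∷ enc η)) ×
  Represents τ η (f (bar σ))

-- f is made of tents on the dyadic intervals [2^-(i+1), 2^-i], the i-th of slope
-- 2^-(i²), so it is 1-Lipschitz and rational on rationals. At x = 0ⁱ1b the binary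
-- expansion of f x is i² + i + 2 zeros followed by the digits of the tent map at 0.b,
-- which a machine emits in linear time: it sweeps a head i times across a counter of
-- length i, then copies or complements b. But f (0ⁱ11) = 2^-(i² + i + 2), and every
-- eventually periodic representation of it has a preperiod of at least that length,
-- more than a machine running in time O(i) can write.

module Submission where

open import Defs
open import Data.Bool using (Bool; true; false; not; if_then_else_)
open import Data.Empty using (⊥-elim)
open import Data.Fin using (Fin; zero; suc)
open import Data.Integer as ℤ using (ℤ; +_; -[1+_]; +≤+)
import Data.Integer.Properties as ℤP
open import Data.List using (List; []; _∷_; _++_; _ʳ++_; map; length; replicate; drop)
import Data.List.Properties as LP
open import Data.List.Relation.Unary.All using (All; []; _∷_)
open import Data.List.Relation.Unary.All.Properties using (++⁺)
open import Data.Nat as ℕ using (ℕ; zero; suc; z≤n; s≤s; _^_)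
open import Data.Nat.Coprimality using (1-coprimeTo)
import Data.Nat.Properties as ℕP
open import Data.Nat.Tactic.RingSolver using (solve-∀)
open import Data.Rational as ℚ using (ℚ; mkℚ; 0ℚ; 1ℚ; ½; ∣_∣; _+_; _*_; _-_; -_; _≤_; _<_; _⊓_; _≤?_; _<?_)
import Data.Rational.Properties as ℚP
open import Data.Rational.Solver using (module +-*-Solver)
open import Data.Product using (Σ; _×_; _,_; proj₁; proj₂)
open import Data.Sum using (_⊎_; inj₁; inj₂)
open import Data.Vec as Vec using (Vec; _∷_; [])
open import Function using (_∘_)
import Data.Vec.Properties as VecP
open import Relation.Binary.Definitions using (tri<; tri≈; tri>)
open import Relation.Binary.PropositionalEquality
open import Relation.Nullary using (¬_; Dec; yes; no; does; _×-dec_)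

open +-*-Solver

-- Tapes as zippers

i-suc[j]≡pred[i-j] : ∀ i j → i ℤ.- ℤ.suc j ≡ ℤ.pred (i ℤ.- j)
i-suc[j]≡pred[i-j] i j = trans (cong (λ k → i ℤ.+ k) (ℤP.neg-distrib-+ ℤ.1ℤ j)) (ℤP.+-pred i (ℤ.- j))

i-pred[j]≡suc[i-j] : ∀ i j → i ℤ.- ℤ.pred j ≡ ℤ.suc (i ℤ.- j)
i-pred[j]≡suc[i-j] i j = begin
  i ℤ.- ℤ.pred j                    ≡⟨ ℤP.suc-pred (i ℤ.- ℤ.pred j) ⟨
  ℤ.suc (ℤ.pred (i ℤ.- ℤ.pred j))   ≡⟨ cong ℤ.suc (i-suc[j]≡pred[i-j] i (ℤ.pred j)) ⟨
  ℤ.suc (i ℤ.- ℤ.suc (ℤ.pred j))    ≡⟨ cong (λ k → ℤ.suc (i ℤ.- k)) (ℤP.suc-pred j) ⟩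
  ℤ.suc (i ℤ.- j)                   ∎
  where open ≡-Reasoning

module _ {g : ℕ} where

  headOrBlank : List (Sym g) → Sym g
  headOrBlank []      = blank
  headOrBlank (a ∷ _) = a

  nthOrBlank : List (Sym g) → ℕ → Sym g
  nthOrBlank []      _       = blank
  nthOrBlank (a ∷ _) zero    = a
  nthOrBlank (_ ∷ w) (suc k) = nthOrBlank w k

  -- Pushing a blank onto an empty side is a no-op, so a head that walks
  -- into unwritten cells and back leaves its zipper unchanged.
  push : Sym g → List (Sym g) → List (Sym g)
  push zero    []      = []
  push zero    (b ∷ w) = zero ∷ b ∷ w
  push (suc a) w       = suc a ∷ w

  nthOrBlank-push : ∀ a w k → nthOrBlank (push a w) k ≡ nthOrBlank (a ∷ w) k
  nthOrBlank-push zero    []      zero    = refl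
  nthOrBlank-push zero    []      (suc k) = refl
  nthOrBlank-push zero    (b ∷ w) k       = refl
  nthOrBlank-push (suc a) w       k       = refl

  cellAt : List (Sym g) → Sym g → List (Sym g) → ℤ → Sym g
  cellAt ls a rs (+ zero)  = a
  cellAt ls a rs (+ suc k) = nthOrBlank rs k
  cellAt ls a rs -[1+ k ]  = nthOrBlank ls k

  record Zipper : Set where
    constructor zipper
    field
      lefts    : List (Sym g)
      focus    : Sym g
      rights   : List (Sym g)
      position : ℤ
  open Zipper public

  contents : Zipper → ℤ → Sym g
  contents (zipper ls a rs p) z = cellAt ls a rs (z ℤ.- p)

  shift : Move → Zipper → Zipper
  shift right (zipper ls a rs p) = zipper (push a ls) (headOrBlank rs) (drop 1 rs) (ℤ.suc p)
  shift left  (zipper ls a rs p) = zipper (drop 1 ls) (headOrBlank ls) (push a rs) (ℤ.pred p)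
  shift stay  z                  = z

  overwrite : Zipper → Sym g → Zipper
  overwrite (zipper ls _ rs p) a = zipper ls a rs p

  cellAt-shiftRight : ∀ ls a rs d →
    cellAt (push a ls) (headOrBlank rs) (drop 1 rs) (ℤ.pred d) ≡ cellAt ls a rs d
  cellAt-shiftRight ls a rs       (+ zero)        = nthOrBlank-push a ls 0
  cellAt-shiftRight ls a []       (+ suc zero)    = refl
  cellAt-shiftRight ls a (_ ∷ _)  (+ suc zero)    = refl
  cellAt-shiftRight ls a []       (+ suc (suc k)) = refl
  cellAt-shiftRight ls a (_ ∷ _)  (+ suc (suc k)) = refl
  cellAt-shiftRight ls a rs       -[1+ k ]        = nthOrBlank-push a ls (suc k)

  cellAt-shiftLeft : ∀ ls a rs d →
    cellAt (drop 1 ls) (headOrBlank ls) (push a rs) (ℤ.suc d) ≡ cellAt ls a rs d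
  cellAt-shiftLeft ls      a rs (+ zero)        = nthOrBlank-push a rs 0
  cellAt-shiftLeft ls      a rs (+ suc k)       = nthOrBlank-push a rs (suc k)
  cellAt-shiftLeft []      a rs -[1+ zero ]     = refl
  cellAt-shiftLeft (_ ∷ _) a rs -[1+ zero ]     = refl
  cellAt-shiftLeft []      a rs -[1+ suc k ]    = refl
  cellAt-shiftLeft (_ ∷ _) a rs -[1+ suc k ]    = refl

  contents-shift : ∀ m Z z → contents (shift m Z) z ≡ contents Z z
  contents-shift right (zipper ls a rs p) z =
    trans (cong (cellAt _ _ _) (i-suc[j]≡pred[i-j] z p)) (cellAt-shiftRight ls a rs (z ℤ.- p))
  contents-shift left (zipper ls a rs p) z =
    trans (cong (cellAt _ _ _) (i-pred[j]≡suc[i-j] z p)) (cellAt-shiftLeft ls a rs (z ℤ.- p))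
  contents-shift stay Z z = refl

  contents-focus : ∀ Z → contents Z (position Z) ≡ focus Z
  contents-focus (zipper ls a rs p) = cong (cellAt ls a rs) (ℤP.+-inverseʳ p)

  contents-overwrite : ∀ Z a z →
    contents (overwrite Z a) z ≡ (if does (z ℤ.≟ position Z) then a else contents Z z)
  contents-overwrite Z@(zipper ls b rs p) a z with z ℤ.≟ p
  ... | yes refl = contents-focus (overwrite Z a)
  ... | no z≢p   = offFocus (z ℤ.- p) (z≢p ∘ ℤP.i-j≡0⇒i≡j z p)
    where
    offFocus : ∀ d → d ≢ + 0 → cellAt ls a rs d ≡ cellAt ls b rs d
    offFocus (+ zero)  d≢0 = ⊥-elim (d≢0 refl)
    offFocus (+ suc k) _   = refl
    offFocus -[1+ k ]  _   = refl

  cellAt-push : ∀ ls b a rs d → cellAt ls b (push a rs) d ≡ cellAt ls b (a ∷ rs) d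
  cellAt-push ls b a rs (+ zero)  = refl
  cellAt-push ls b a rs (+ suc k) = nthOrBlank-push a rs k
  cellAt-push ls b a rs -[1+ k ]  = refl

  cellAt-blank : ∀ d → cellAt [] blank [] d ≡ blank
  cellAt-blank (+ zero)  = refl
  cellAt-blank (+ suc k) = refl
  cellAt-blank -[1+ k ]  = refl

module _ (M : TM) where
  open TM M

  Holds-cong : ∀ {t t′ : ℤ → Sym g} z w → (∀ x → t x ≡ t′ x) → Holds M t z w → Holds M t′ z w
  Holds-cong z []      t≗t′ h        = trans (sym (t≗t′ z)) h
  Holds-cong z (a ∷ w) t≗t′ (h , hs) = trans (sym (t≗t′ z)) h , Holds-cong _ w t≗t′ hs

  Holds-at : ∀ {t : ℤ → Sym g} {z z′} w → z ≡ z′ → Holds M t z w → Holds M t z′ w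
  Holds-at w refl h = h

  Holds-focus∷rights : ∀ ls a rs p → Holds M (contents (zipper ls a rs p)) p (a ∷ rs)
  Holds-focus∷rights ls a rs p = contents-focus (zipper ls a rs p) , Holds-at rs (ℤP.+-comm ℤ.1ℤ p) (rest rs)
    where
    rest : ∀ rs → Holds M (contents (zipper ls a rs p)) (ℤ.suc p) rs
    rest []       = Holds-cong (ℤ.suc p) [] (contents-shift right (zipper ls a [] p))
                      (contents-focus (shift right (zipper ls a [] p)))
    rest (b ∷ bs) = Holds-cong (ℤ.suc p) (b ∷ bs) (contents-shift right (zipper ls a (b ∷ bs) p))
                      (Holds-focus∷rights (push a ls) b bs (ℤ.suc p))

  Holds-lefts : ∀ ls a rs p → Holds M (contents (zipper ls a rs p)) (p ℤ.- + length ls) (ls ʳ++ a ∷ rs)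
  Holds-lefts []       a rs p = Holds-at (a ∷ rs) (sym (ℤP.+-identityʳ p)) (Holds-focus∷rights [] a rs p)
  Holds-lefts (b ∷ ls) a rs p =
    Holds-at (ls ʳ++ b ∷ a ∷ rs) (sym (trans (ℤP.minus-suc p (length ls)) (sym (ℤP.pred-+ p (ℤ.- + length ls)))))
      (Holds-cong _ (ls ʳ++ b ∷ a ∷ rs) contents≗ (Holds-lefts ls b (a ∷ rs) (ℤ.pred p)))
    where
    contents≗ : ∀ x → contents (zipper ls b (a ∷ rs) (ℤ.pred p)) x ≡ contents (zipper (b ∷ ls) a rs p) x
    contents≗ x = trans (sym (cellAt-push ls b a rs (x ℤ.- ℤ.pred p))) (contents-shift left (zipper (b ∷ ls) a rs p) x)

  Holds-dropLastBlank : ∀ {t : ℤ → Sym g} {z} w → Holds M t z (w ++ blank ∷ []) → Holds M t z w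
  Holds-dropLastBlank []      (h , _)  = h
  Holds-dropLastBlank (a ∷ w) (h , hs) = h , Holds-dropLastBlank w hs

  Holds-written : ∀ w → Holds M (contents (zipper (w ʳ++ []) blank [] (+ length w))) (+ 0) w
  Holds-written w =
    Holds-dropLastBlank w (subst (Holds M _ _) (LP.ʳ++-ʳ++ w)
      (Holds-at _ start≡0 (Holds-lefts (w ʳ++ []) blank [] (+ length w))))
    where
    start≡0 : + length w ℤ.- + length (w ʳ++ []) ≡ + 0
    start≡0 = trans (cong (λ n → + length w ℤ.- + n) (trans (LP.length-ʳ++ w) (ℕP.+-identityʳ _)))
                    (ℤP.+-inverseʳ (+ length w))

lookup-extensionality : ∀ {A : Set} {n} (xs ys : Vec A n) → (∀ j → Vec.lookup xs j ≡ Vec.lookup ys j) → xs ≡ ys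
lookup-extensionality xs ys eq =
  trans (sym (VecP.tabulate∘lookup xs)) (trans (VecP.tabulate-cong eq) (VecP.tabulate∘lookup ys))

module ZipperRun (M : TM) where
  open TM M

  record ZConfig : Set where
    constructor zconfig
    field
      zstate  : Fin q
      zippers : Vec (Zipper {g}) (2 ℕ.+ k)
  open ZConfig public

  zstep : ZConfig → ZConfig
  zstep c with halting (zstate c)
  ... | true  = c
  ... | false =
    let r = δ (zstate c) (Vec.map focus (zippers c))
        s′ = proj₁ r ; w = proj₁ (proj₂ r) ; m = proj₂ (proj₂ r)
    in zconfig s′ (Vec.zipWith shift m (Vec.zipWith overwrite (zippers c) w))

  zrun : ℕ → ZConfig → ZConfig
  zrun zero    c = c
  zrun (suc n) c = zrun n (zstep c)

  zrun-+ : ∀ a b c → zrun (a ℕ.+ b) c ≡ zrun b (zrun a c)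
  zrun-+ zero    b c = refl
  zrun-+ (suc a) b c = zrun-+ a b (zstep c)

  emptyZipper : Zipper {g}
  emptyZipper = zipper [] blank [] (+ 0)

  inputZipper : List (Sym g) → Zipper {g}
  inputZipper w = zipper [] (headOrBlank w) (drop 1 w) (+ 0)

  zinitial : List (Sym g) → ZConfig
  zinitial w = zconfig start (inputZipper w ∷ Vec.replicate _ emptyZipper)

  Simulates : Config M → ZConfig → Set
  Simulates c z = Config.state c ≡ zstate z ×
    (∀ j → Vec.lookup (Config.heads c) j ≡ position (Vec.lookup (zippers z) j)) ×
    (∀ j x → Vec.lookup (Config.tapes c) j x ≡ contents (Vec.lookup (zippers z) j) x)

  position-shift : ∀ m (Z : Zipper {g}) a → position (shift m (overwrite Z a)) ≡ move M m (position Z)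
  position-shift right (zipper _ _ _ p) a = ℤP.+-comm ℤ.1ℤ p
  position-shift left  (zipper _ _ _ p) a = ℤP.+-comm ℤ.-1ℤ p
  position-shift stay  (zipper _ _ _ p) a = refl

  write-overwrite : ∀ (t : Tape M) Z a x → (∀ y → t y ≡ contents Z y) →
    write M t (position Z) a x ≡ contents (overwrite Z a) x
  write-overwrite t Z a x t≗Z rewrite contents-overwrite Z a x with x ℤ.≟ position Z
  ... | yes _ = refl
  ... | no _  = t≗Z x

  symbols-read : ∀ hs (ts : Vec (Tape M) (2 ℕ.+ k)) zs →
    (∀ j → Vec.lookup hs j ≡ position (Vec.lookup zs j)) → (∀ j x → Vec.lookup ts j x ≡ contents (Vec.lookup zs j) x) →
    Vec.zipWith (λ t h → t h) ts hs ≡ Vec.map focus zs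
  symbols-read hs ts zs hs≡ ts≗ = lookup-extensionality _ _ λ j → begin
    Vec.lookup (Vec.zipWith (λ t h → t h) ts hs) j          ≡⟨ VecP.lookup-zipWith _ j ts hs ⟩
    Vec.lookup ts j (Vec.lookup hs j)                       ≡⟨ ts≗ j _ ⟩
    contents (Vec.lookup zs j) (Vec.lookup hs j)            ≡⟨ cong (contents (Vec.lookup zs j)) (hs≡ j) ⟩
    contents (Vec.lookup zs j) (position (Vec.lookup zs j)) ≡⟨ contents-focus (Vec.lookup zs j) ⟩
    focus (Vec.lookup zs j)                                 ≡⟨ VecP.lookup-map j focus zs ⟨
    Vec.lookup (Vec.map focus zs) j                         ∎
    where open ≡-Reasoning

  step-simulated : ∀ c z → Simulates c z → Simulates (step M c) (zstep z)
  step-simulated (config s hs ts) (zconfig .s zs) (refl , hs≡ , ts≗) with halting s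
  ... | true  = refl , hs≡ , ts≗
  ... | false rewrite symbols-read hs ts zs hs≡ ts≗ = refl , heads≡ , tapes≗
    where
    open ≡-Reasoning
    r = δ s (Vec.map focus zs)
    w = proj₁ (proj₂ r)
    m = proj₂ (proj₂ r)
    zs′ = Vec.zipWith shift m (Vec.zipWith overwrite zs w)
    lookup-zs′ : ∀ j → Vec.lookup zs′ j ≡ shift (Vec.lookup m j) (overwrite (Vec.lookup zs j) (Vec.lookup w j))
    lookup-zs′ j = trans (VecP.lookup-zipWith shift j m _)
                         (cong (shift (Vec.lookup m j)) (VecP.lookup-zipWith overwrite j zs w))
    heads≡ : ∀ j → Vec.lookup (Vec.zipWith (move M) m hs) j ≡ position (Vec.lookup zs′ j)
    heads≡ j = begin
      Vec.lookup (Vec.zipWith (move M) m hs) j            ≡⟨ VecP.lookup-zipWith _ j m hs ⟩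
      move M (Vec.lookup m j) (Vec.lookup hs j)           ≡⟨ cong (move M (Vec.lookup m j)) (hs≡ j) ⟩
      move M (Vec.lookup m j) (position (Vec.lookup zs j)) ≡⟨ position-shift (Vec.lookup m j) (Vec.lookup zs j) (Vec.lookup w j) ⟨
      position (shift (Vec.lookup m j) (overwrite (Vec.lookup zs j) (Vec.lookup w j))) ≡⟨ cong position (lookup-zs′ j) ⟨
      position (Vec.lookup zs′ j)                         ∎
    writeAll = Vec.zipWith (λ t hw → write M t (proj₁ hw) (proj₂ hw)) ts (Vec.zip hs w)
    tapes≗ : ∀ j x → Vec.lookup writeAll j x ≡ contents (Vec.lookup zs′ j) x
    tapes≗ j x = begin
      Vec.lookup writeAll j x
        ≡⟨ cong (λ t → t x) (VecP.lookup-zipWith (λ t hw → write M t (proj₁ hw) (proj₂ hw)) j ts (Vec.zip hs w)) ⟩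
      write M (Vec.lookup ts j) (proj₁ (Vec.lookup (Vec.zip hs w) j)) (proj₂ (Vec.lookup (Vec.zip hs w) j)) x
        ≡⟨ cong (λ hw → write M (Vec.lookup ts j) (proj₁ hw) (proj₂ hw) x) (VecP.lookup-zip j hs w) ⟩
      write M (Vec.lookup ts j) (Vec.lookup hs j) (Vec.lookup w j) x
        ≡⟨ cong (λ h → write M (Vec.lookup ts j) h (Vec.lookup w j) x) (hs≡ j) ⟩
      write M (Vec.lookup ts j) (position (Vec.lookup zs j)) (Vec.lookup w j) x
        ≡⟨ write-overwrite (Vec.lookup ts j) (Vec.lookup zs j) (Vec.lookup w j) x (ts≗ j) ⟩
      contents (overwrite (Vec.lookup zs j) (Vec.lookup w j)) x
        ≡⟨ contents-shift (Vec.lookup m j) _ x ⟨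
      contents (shift (Vec.lookup m j) (overwrite (Vec.lookup zs j) (Vec.lookup w j))) x
        ≡⟨ cong (λ Z → contents Z x) (lookup-zs′ j) ⟨
      contents (Vec.lookup zs′ j) x ∎

  run-simulated : ∀ n c z → Simulates c z → Simulates (run M n c) (zrun n z)
  run-simulated zero    c z sim = sim
  run-simulated (suc n) c z sim = run-simulated n (step M c) (zstep z) (step-simulated c z sim)

  listTape≡nthOrBlank : ∀ w n → listTape M w n ≡ nthOrBlank w n
  listTape≡nthOrBlank []      n       = refl
  listTape≡nthOrBlank (a ∷ w) zero    = refl
  listTape≡nthOrBlank (a ∷ w) (suc n) = listTape≡nthOrBlank w n

  inputTape≗inputZipper : ∀ w x → inputTape M w x ≡ contents (inputZipper w) x
  inputTape≗inputZipper w x = trans (onCells w x) (cong (cellAt [] (headOrBlank w) (drop 1 w)) (sym (ℤP.+-identityʳ x)))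
    where
    onCells : ∀ w x → inputTape M w x ≡ cellAt [] (headOrBlank w) (drop 1 w) x
    onCells []      (+ zero)  = refl
    onCells (a ∷ w) (+ zero)  = refl
    onCells []      (+ suc n) = refl
    onCells (a ∷ w) (+ suc n) = listTape≡nthOrBlank w n
    onCells w       -[1+ n ]  = refl

  initial-simulated : ∀ w → Simulates (initial M w) (zinitial w)
  initial-simulated w = refl , heads≡ , tapes≗
    where
    heads≡ : ∀ j → Vec.lookup (Vec.replicate (2 ℕ.+ k) (+ 0)) j ≡ position (Vec.lookup (zippers (zinitial w)) j)
    heads≡ zero    = refl
    heads≡ (suc j) = trans (VecP.lookup-replicate j (+ 0)) (sym (cong position (VecP.lookup-replicate j emptyZipper)))
    tapes≗ : ∀ j x → Vec.lookup (Config.tapes (initial M w)) j x ≡ contents (Vec.lookup (zippers (zinitial w)) j) x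
    tapes≗ zero    x = inputTape≗inputZipper w x
    tapes≗ (suc j) x = begin
      Vec.lookup (Vec.replicate (suc k) (λ _ → blank)) j x ≡⟨ cong (λ t → t x) (VecP.lookup-replicate j (λ _ → blank)) ⟩
      blank                                                ≡⟨ cellAt-blank (x ℤ.- + 0) ⟨
      contents emptyZipper x                               ≡⟨ cong (λ Z → contents Z x) (VecP.lookup-replicate j emptyZipper) ⟨
      contents (Vec.lookup (Vec.replicate (suc k) emptyZipper) j) x ∎
      where open ≡-Reasoning

  haltsWithin-zrun : ∀ w T out t → t ℕ.≤ T → halting (zstate (zrun t (zinitial w))) ≡ true →
    Holds M (contents (Vec.lookup (zippers (zrun t (zinitial w))) (suc zero))) (+ 0) out → HaltsWithin M w T out
  haltsWithin-zrun w T out t t≤T halts holds with run-simulated t (initial M w) (zinitial w) (initial-simulated w)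
  ... | state≡ , _ , tapes≗ =
    t , t≤T , trans (cong halting state≡) halts , Holds-cong M (+ 0) out (λ x → sym (tapes≗ (suc zero) x)) holds

-- Output length in bounded time

module _ (M : TM) where
  open TM M

  OutputBlankFrom : ℕ → Config M → Set
  OutputBlankFrom t c = Vec.lookup (Config.heads c) (suc zero) ℤ.≤ + t ×
    (∀ z → + t ℤ.≤ z → Vec.lookup (Config.tapes c) (suc zero) z ≡ blank)

  move-≤ : ∀ m {h t} → h ℤ.≤ + t → move M m h ℤ.≤ + suc t
  move-≤ right {h} h≤t = subst (ℤ._≤ _) (ℤP.+-comm ℤ.1ℤ h) (ℤP.suc-mono h≤t)
  move-≤ left  {h} h≤t = subst (ℤ._≤ _) (ℤP.+-comm ℤ.-1ℤ h) (ℤP.i≤j⇒i≤1+j (ℤP.i≤j⇒pred[i]≤j h≤t))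
  move-≤ stay      h≤t = ℤP.i≤j⇒i≤1+j h≤t

  step-outputBlankFrom : ∀ t c → OutputBlankFrom t c → OutputBlankFrom (suc t) (step M c)
  step-outputBlankFrom t (config s hs ts) (h≤t , blankFrom) with halting s
  ... | true  = ℤP.i≤j⇒i≤1+j h≤t , λ z t<z → blankFrom z (ℤP.≤-trans (ℤP.i≤suc[i] (+ t)) t<z)
  ... | false = head≤ , blankFrom′
    where
    r = δ s (Vec.zipWith (λ t h → t h) ts hs)
    w = proj₁ (proj₂ r)
    m = proj₂ (proj₂ r)
    head≤ : Vec.lookup (Vec.zipWith (move M) m hs) (suc zero) ℤ.≤ + suc t
    head≤ = subst (ℤ._≤ + suc t) (sym (VecP.lookup-zipWith (move M) (suc zero) m hs))
              (move-≤ (Vec.lookup m (suc zero)) h≤t)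
    blankFrom′ : ∀ z → + suc t ℤ.≤ z →
      Vec.lookup (Vec.zipWith (λ t hw → write M t (proj₁ hw) (proj₂ hw)) ts (Vec.zip hs w)) (suc zero) z ≡ blank
    blankFrom′ z t<z rewrite VecP.lookup-zipWith (λ t hw → write M t (proj₁ hw) (proj₂ hw)) (suc zero) ts (Vec.zip hs w)
                           | VecP.lookup-zip (suc zero) hs w
      with z ℤ.≟ Vec.lookup hs (suc zero)
    ... | yes refl = ⊥-elim (ℕP.<-irrefl refl (ℤP.drop‿+≤+ (ℤP.≤-trans t<z h≤t)))
    ... | no _     = blankFrom z (ℤP.≤-trans (ℤP.i≤suc[i] (+ t)) t<z)

  run-outputBlankFrom : ∀ n t c → OutputBlankFrom t c → OutputBlankFrom (n ℕ.+ t) (run M n c)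
  run-outputBlankFrom zero    t c inv = inv
  run-outputBlankFrom (suc n) t c inv = subst (λ u → OutputBlankFrom u (run M n (step M c))) (ℕP.+-suc n t)
    (run-outputBlankFrom n (suc t) (step M c) (step-outputBlankFrom t c inv))

  initial-outputBlankFrom : ∀ w → OutputBlankFrom 0 (initial M w)
  initial-outputBlankFrom w = ℤP.≤-refl , λ _ _ → refl

  Holds-length≤ : ∀ (t : Tape M) T j w → (∀ z → + T ℤ.≤ z → t z ≡ blank) → Holds M t (+ j) w →
    All (_≢ blank) w → j ℕ.≤ T → j ℕ.+ length w ℕ.≤ T
  Holds-length≤ t T j []      _         _         _           j≤T = subst (ℕ._≤ T) (sym (ℕP.+-identityʳ j)) j≤T
  Holds-length≤ t T j (a ∷ w) blankFrom (ta , tw) (a≢b ∷ w≢b) j≤T with j ℕ.≟ T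
  ... | yes refl = ⊥-elim (a≢b (trans (sym ta) (blankFrom (+ j) ℤP.≤-refl)))
  ... | no j≢T   = subst (ℕ._≤ T) (sym (ℕP.+-suc j (length w)))
    (Holds-length≤ t T (suc j) w blankFrom (Holds-at M w (ℤP.+-comm (+ j) ℤ.1ℤ) tw) w≢b (ℕP.≤∧≢⇒< j≤T j≢T))

  haltsWithin-length≤ : ∀ w T out → All (_≢ blank) out → HaltsWithin M w T out → length out ℕ.≤ T
  haltsWithin-length≤ w T out out≢b (t , t≤T , _ , holds) =
    ℕP.≤-trans (Holds-length≤ _ t 0 out blankFrom holds out≢b z≤n) t≤T
    where
    blankFrom : ∀ z → + t ℤ.≤ z → Vec.lookup (Config.tapes (run M t (initial M w))) (suc zero) z ≡ blank
    blankFrom z t≤z = proj₂ (run-outputBlankFrom t 0 (initial M w) (initial-outputBlankFrom w)) z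
                        (subst (λ u → + u ℤ.≤ z) (sym (ℕP.+-identityʳ t)) t≤z)

0<1 : 0ℚ < 1ℚ
0<1 = ℚP.positive⁻¹ 1ℚ

0≤1 : 0ℚ ≤ 1ℚ
0≤1 = ℚP.<⇒≤ 0<1

p≤q⇒0≤q-p : ∀ {p q} → p ≤ q → 0ℚ ≤ q - p
p≤q⇒0≤q-p {p} {q} p≤q = subst (_≤ q - p) (ℚP.+-inverseʳ p) (ℚP.+-monoˡ-≤ (- p) p≤q)

0≤q-p⇒p≤q : ∀ {p q} → 0ℚ ≤ q - p → p ≤ q
0≤q-p⇒p≤q {p} {q} 0≤q-p =
  subst₂ _≤_ (ℚP.+-identityˡ p) (solve 2 (λ p q → (q :- p) :+ p := q) refl p q) (ℚP.+-monoˡ-≤ p 0≤q-p)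

p<q⇒0<q-p : ∀ {p q} → p < q → 0ℚ < q - p
p<q⇒0<q-p {p} {q} p<q = subst (_< q - p) (ℚP.+-inverseʳ p) (ℚP.+-monoˡ-< (- p) p<q)

0<q-p⇒p<q : ∀ {p q} → 0ℚ < q - p → p < q
0<q-p⇒p<q {p} {q} 0<q-p =
  subst₂ _<_ (ℚP.+-identityˡ p) (solve 2 (λ p q → (q :- p) :+ p := q) refl p q) (ℚP.+-monoˡ-< p 0<q-p)

≤-byDifference : ∀ {p q} d → q - p ≡ d → 0ℚ ≤ d → p ≤ q
≤-byDifference d q-p≡d 0≤d = 0≤q-p⇒p≤q (subst (0ℚ ≤_) (sym q-p≡d) 0≤d)

+-nonNeg : ∀ {p q} → 0ℚ ≤ p → 0ℚ ≤ q → 0ℚ ≤ p + q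
+-nonNeg {p} {q} 0≤p 0≤q = subst (_≤ p + q) (ℚP.+-identityˡ 0ℚ) (ℚP.+-mono-≤ 0≤p 0≤q)

*-nonNeg : ∀ {p q} → 0ℚ ≤ p → 0ℚ ≤ q → 0ℚ ≤ p * q
*-nonNeg {p} {q} 0≤p 0≤q = subst (_≤ p * q) (ℚP.*-zeroʳ p) (ℚP.*-monoˡ-≤-nonNeg p {{ℚ.nonNegative 0≤p}} 0≤q)

*-pos : ∀ {p q} → 0ℚ < p → 0ℚ < q → 0ℚ < p * q
*-pos {p} {q} 0<p 0<q = subst (_< p * q) (ℚP.*-zeroʳ p) (ℚP.*-monoʳ-<-pos p {{ℚ.positive 0<p}} 0<q)

c≤1⇒c*p≤p : ∀ {c p} → c ≤ 1ℚ → 0ℚ ≤ p → c * p ≤ p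
c≤1⇒c*p≤p {c} {p} c≤1 0≤p = subst (c * p ≤_) (ℚP.*-identityˡ p) (ℚP.*-monoʳ-≤-nonNeg p {{ℚ.nonNegative 0≤p}} c≤1)

-q≤p≤q⇒∣p∣≤q : ∀ {p q} → - q ≤ p → p ≤ q → ∣ p ∣ ≤ q
-q≤p≤q⇒∣p∣≤q {p} {q} -q≤p p≤q with ℚP.∣p∣≡p∨∣p∣≡-p p
... | inj₁ ∣p∣≡p  = subst (_≤ q) (sym ∣p∣≡p) p≤q
... | inj₂ ∣p∣≡-p = subst (_≤ q) (sym ∣p∣≡-p)
                      (subst (- p ≤_) (solve 1 (λ q → :- (:- q) := q) refl q) (ℚP.neg-antimono-≤ -q≤p))

∣p-q∣≡∣q-p∣ : ∀ p q → ∣ p - q ∣ ≡ ∣ q - p ∣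
∣p-q∣≡∣q-p∣ p q = trans (cong ∣_∣ (solve 2 (λ p q → p :- q := :- (q :- p)) refl p q)) (ℚP.∣-p∣≡∣p∣ (q - p))

p≤q⇒∣p-q∣≡q-p : ∀ {p q} → p ≤ q → ∣ p - q ∣ ≡ q - p
p≤q⇒∣p-q∣≡q-p {p} {q} p≤q = trans (∣p-q∣≡∣q-p∣ p q) (ℚP.0≤p⇒∣p∣≡p (p≤q⇒0≤q-p p≤q))

½*p<p : ∀ {p} → 0ℚ < p → ½ * p < p
½*p<p {p} 0<p = begin-strict
  ½ * p          ≡⟨ ℚP.+-identityʳ (½ * p) ⟨
  ½ * p + 0ℚ     <⟨ ℚP.+-monoʳ-< (½ * p) (ℚP.*-monoʳ-<-pos ½ 0<p) ⟩
  ½ * p + ½ * p  ≡⟨ solve 1 (λ p → con ½ :* p :+ con ½ :* p := p) refl p ⟩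
  p              ∎
  where open ℚP.≤-Reasoning

½*-injective : ∀ {p q} → ½ * p ≡ ½ * q → p ≡ q
½*-injective {p} {q} eq = begin
  p                     ≡⟨ solve 1 (λ p → p := (con 1ℚ :+ con 1ℚ) :* (con ½ :* p)) refl p ⟩
  (1ℚ + 1ℚ) * (½ * p)   ≡⟨ cong ((1ℚ + 1ℚ) *_) eq ⟩
  (1ℚ + 1ℚ) * (½ * q)   ≡⟨ solve 1 (λ q → (con 1ℚ :+ con 1ℚ) :* (con ½ :* q) := q) refl q ⟩
  q                     ∎
  where open ≡-Reasoning

pow2inv-pos : ∀ n → 0ℚ < pow2inv n
pow2inv-pos zero    = 0<1
pow2inv-pos (suc n) = ℚP.*-monoʳ-<-pos ½ (pow2inv-pos n)

pow2inv-nonNeg : ∀ n → 0ℚ ≤ pow2inv n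
pow2inv-nonNeg n = ℚP.<⇒≤ (pow2inv-pos n)

pow2inv-suc< : ∀ n → pow2inv (suc n) < pow2inv n
pow2inv-suc< n = ½*p<p (pow2inv-pos n)

pow2inv-antitone : ∀ {m n} → m ℕ.≤ n → pow2inv n ≤ pow2inv m
pow2inv-antitone {n = zero}  z≤n       = ℚP.≤-refl
pow2inv-antitone {n = suc n} z≤n       = ℚP.≤-trans (ℚP.<⇒≤ (pow2inv-suc< n)) (pow2inv-antitone {n = n} z≤n)
pow2inv-antitone             (s≤s m≤n) = ℚP.*-monoˡ-≤-nonNeg ½ (pow2inv-antitone m≤n)

pow2inv-strict : ∀ {m n} → m ℕ.< n → pow2inv n < pow2inv m
pow2inv-strict {m} m<n = ℚP.≤-<-trans (pow2inv-antitone m<n) (pow2inv-suc< m)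

pow2inv≤1 : ∀ n → pow2inv n ≤ 1ℚ
pow2inv≤1 n = pow2inv-antitone {0} {n} z≤n

pow2inv-+ : ∀ m n → pow2inv (m ℕ.+ n) ≡ pow2inv m * pow2inv n
pow2inv-+ zero    n = sym (ℚP.*-identityˡ (pow2inv n))
pow2inv-+ (suc m) n = trans (cong (½ *_) (pow2inv-+ m n)) (sym (ℚP.*-assoc ½ (pow2inv m) (pow2inv n)))

pow2-pos : ∀ n → 0ℚ < pow2 n
pow2-pos zero    = 0<1
pow2-pos (suc n) = *-pos (ℚP.positive⁻¹ (1ℚ + 1ℚ)) (pow2-pos n)

pow2inv*pow2 : ∀ n → pow2inv n * pow2 n ≡ 1ℚ
pow2inv*pow2 zero    = refl
pow2inv*pow2 (suc n) =
  trans (solve 2 (λ a b → (con ½ :* a) :* ((con 1ℚ :+ con 1ℚ) :* b) := a :* b) refl (pow2inv n) (pow2 n)) (pow2inv*pow2 n)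

bit-In01 : ∀ b → In01 (bit b)
bit-In01 false = ℚP.≤-refl , 0≤1
bit-In01 true  = 0≤1 , ℚP.≤-refl

½*[p+q]-In01 : ∀ {p q} → In01 p → In01 q → In01 (½ * (p + q))
½*[p+q]-In01 (0≤p , p≤1) (0≤q , q≤1) =
  ℚP.*-monoˡ-≤-nonNeg ½ (ℚP.+-mono-≤ 0≤p 0≤q) , ℚP.*-monoˡ-≤-nonNeg ½ (ℚP.+-mono-≤ p≤1 q≤1)

bar-In01 : ∀ w → In01 (bar w)
bar-In01 []      = ℚP.≤-refl , 0≤1
bar-In01 (b ∷ w) = ½*[p+q]-In01 (bit-In01 b) (bar-In01 w)

bar<1 : ∀ w → bar w < 1ℚ
bar<1 []      = 0<1
bar<1 (b ∷ w) = ℚP.*-monoʳ-<-pos ½ {bit b + bar w} {1ℚ + 1ℚ} (ℚP.+-mono-≤-< (proj₂ (bit-In01 b)) (bar<1 w))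

bar≤1-pow2inv-length : ∀ w → bar w ≤ 1ℚ - pow2inv (length w)
bar≤1-pow2inv-length []      = ℚP.≤-reflexive refl
bar≤1-pow2inv-length (b ∷ w) = ≤-byDifference (½ * ((1ℚ - bit b) + ((1ℚ - pow2inv (length w)) - bar w)))
  (solve 3 (λ b z p → (con 1ℚ :- con ½ :* p) :- con ½ :* (b :+ z) := con ½ :* ((con 1ℚ :- b) :+ ((con 1ℚ :- p) :- z)))
     refl (bit b) (bar w) (pow2inv (length w)))
  (*-nonNeg (ℚP.nonNegative⁻¹ ½) (+-nonNeg (p≤q⇒0≤q-p (proj₂ (bit-In01 b))) (p≤q⇒0≤q-p (bar≤1-pow2inv-length w))))

bar≡0⊎pow2inv-length≤bar : ∀ τ → bar τ ≡ 0ℚ ⊎ pow2inv (length τ) ≤ bar τ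
bar≡0⊎pow2inv-length≤bar [] = inj₁ refl
bar≡0⊎pow2inv-length≤bar (true ∷ w) = inj₂ (ℚP.*-monoˡ-≤-nonNeg ½ (ℚP.≤-trans (pow2inv≤1 (length w))
  (≤-byDifference {1ℚ} {1ℚ + bar w} (bar w) (solve 1 (λ z → (con 1ℚ :+ z) :- con 1ℚ := z) refl (bar w))
    (proj₁ (bar-In01 w)))))
bar≡0⊎pow2inv-length≤bar (false ∷ w) with bar≡0⊎pow2inv-length≤bar w
... | inj₁ bar≡0 = inj₁ (cong (λ u → ½ * (0ℚ + u)) bar≡0)
... | inj₂ p≤bar = inj₂ (ℚP.*-monoˡ-≤-nonNeg ½ (subst (pow2inv (length w) ≤_) (sym (ℚP.+-identityˡ (bar w))) p≤bar))

bar-zeros++ : ∀ i w → bar (replicate i false ++ w) ≡ pow2inv i * bar w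
bar-zeros++ zero    w = sym (ℚP.*-identityˡ (bar w))
bar-zeros++ (suc i) w = trans (cong (λ u → ½ * (0ℚ + u)) (bar-zeros++ i w))
  (solve 2 (λ p b → con ½ :* (con 0ℚ :+ p :* b) := (con ½ :* p) :* b) refl (pow2inv i) (bar w))

bar-zeros : ∀ m → bar (replicate m false) ≡ 0ℚ
bar-zeros zero    = refl
bar-zeros (suc m) = cong (λ u → ½ * (0ℚ + u)) (bar-zeros m)

-- Eventually periodic binary expansions

-- The value of the binary expansion w c c c ….
expansionValue : List Bool → Bool → ℚ
expansionValue []      c = bit c
expansionValue (b ∷ w) c = ½ * (bit b + expansionValue w c)

expansionPrefix : ℕ → List Bool → Bool → List Bool
expansionPrefix zero    _       _ = []
expansionPrefix (suc m) []      c = c ∷ expansionPrefix m [] c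
expansionPrefix (suc m) (b ∷ w) c = b ∷ expansionPrefix m w c

expansionValue-In01 : ∀ w c → In01 (expansionValue w c)
expansionValue-In01 []      c = bit-In01 c
expansionValue-In01 (b ∷ w) c = ½*[p+q]-In01 (bit-In01 b) (expansionValue-In01 w c)

expansionValue-prefix : ∀ m w c →
  expansionValue w c ≡ bar (expansionPrefix m w c) + pow2inv m * expansionValue (drop m w) c
expansionValue-prefix zero w c = solve 1 (λ v → v := con 0ℚ :+ con 1ℚ :* v) refl (expansionValue w c)
expansionValue-prefix (suc m) [] c = begin
  bit c
    ≡⟨ solve 1 (λ b → b := con ½ :* b :+ con ½ :* b) refl (bit c) ⟩
  ½ * bit c + ½ * bit c
    ≡⟨ cong (λ u → ½ * bit c + ½ * u) (expansionValue-prefix m [] c) ⟩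
  ½ * bit c + ½ * (bar (expansionPrefix m [] c) + pow2inv m * expansionValue (drop m []) c)
    ≡⟨ cong (λ w → ½ * bit c + ½ * (bar (expansionPrefix m [] c) + pow2inv m * expansionValue w c)) (LP.drop-[] m) ⟩
  ½ * bit c + ½ * (bar (expansionPrefix m [] c) + pow2inv m * bit c)
    ≡⟨ solve 3 (λ b P p → con ½ :* b :+ con ½ :* (P :+ p :* b) := con ½ :* (b :+ P) :+ (con ½ :* p) :* b)
         refl (bit c) (bar (expansionPrefix m [] c)) (pow2inv m) ⟩
  ½ * (bit c + bar (expansionPrefix m [] c)) + (½ * pow2inv m) * bit c ∎
  where open ≡-Reasoning
expansionValue-prefix (suc m) (b ∷ w) c = begin
  ½ * (bit b + expansionValue w c)
    ≡⟨ cong (λ u → ½ * (bit b + u)) (expansionValue-prefix m w c) ⟩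
  ½ * (bit b + (bar (expansionPrefix m w c) + pow2inv m * expansionValue (drop m w) c))
    ≡⟨ solve 4 (λ b P p v → con ½ :* (b :+ (P :+ p :* v)) := con ½ :* (b :+ P) :+ (con ½ :* p) :* v)
         refl (bit b) (bar (expansionPrefix m w c)) (pow2inv m) (expansionValue (drop m w) c) ⟩
  ½ * (bit b + bar (expansionPrefix m w c)) + (½ * pow2inv m) * expansionValue (drop m w) c ∎
  where open ≡-Reasoning

expansionPrefix-approx : ∀ n w c → ∣ bar (expansionPrefix (suc n) w c) - expansionValue w c ∣ < pow2inv n
expansionPrefix-approx n w c = begin-strict
  ∣ P - expansionValue w c ∣ ≡⟨ cong (λ u → ∣ P - u ∣) (expansionValue-prefix (suc n) w c) ⟩
  ∣ P - (P + q * v) ∣        ≡⟨ cong ∣_∣ (solve 3 (λ P q v → P :- (P :+ q :* v) := :- (q :* v)) refl P q v) ⟩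
  ∣ - (q * v) ∣              ≡⟨ ℚP.∣-p∣≡∣p∣ (q * v) ⟩
  ∣ q * v ∣                  ≡⟨ ℚP.0≤p⇒∣p∣≡p (*-nonNeg (pow2inv-nonNeg (suc n)) (proj₁ v-In01)) ⟩
  q * v                      ≤⟨ ℚP.*-monoˡ-≤-nonNeg q {{ℚ.nonNegative (pow2inv-nonNeg (suc n))}} (proj₂ v-In01) ⟩
  q * 1ℚ                     ≡⟨ ℚP.*-identityʳ q ⟩
  q                          <⟨ pow2inv-suc< n ⟩
  pow2inv n                  ∎
  where
  open ℚP.≤-Reasoning
  P = bar (expansionPrefix (suc n) w c)
  q = pow2inv (suc n)
  v = expansionValue (drop (suc n) w) c
  v-In01 = expansionValue-In01 (drop (suc n) w) c

expansionValue-zeros++ : ∀ k w c → expansionValue (replicate k false ++ w) c ≡ pow2inv k * expansionValue w c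
expansionValue-zeros++ zero    w c = sym (ℚP.*-identityˡ (expansionValue w c))
expansionValue-zeros++ (suc k) w c = trans (cong (λ u → ½ * (0ℚ + u)) (expansionValue-zeros++ k w c))
  (solve 2 (λ p v → con ½ :* (con 0ℚ :+ p :* v) := (con ½ :* p) :* v) refl (pow2inv k) (expansionValue w c))

expansionValue-false : ∀ w → expansionValue w false ≡ bar w
expansionValue-false []      = refl
expansionValue-false (b ∷ w) = cong (λ u → ½ * (bit b + u)) (expansionValue-false w)

bit-not : ∀ b → bit (not b) ≡ 1ℚ - bit b
bit-not false = refl
bit-not true  = refl

expansionValue-not : ∀ w → expansionValue (map not w) true ≡ 1ℚ - bar w
expansionValue-not []      = refl
expansionValue-not (b ∷ w) = trans (cong₂ (λ u v → ½ * (u + v)) (bit-not b) (expansionValue-not w))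
  (solve 2 (λ b z → con ½ :* ((con 1ℚ :- b) :+ (con 1ℚ :- z)) := con 1ℚ :- con ½ :* (b :+ z)) refl (bit b) (bar w))

-- 2^-M (1 - 2^-L) is 0.0…01…1 with M zeros and L ones; its last 1, at
-- position M + L, is out of reach of a string of length L.
pow2inv*[1-pow2inv]≢bar : ∀ η M L → 1 ℕ.≤ M → length η ℕ.≤ L → 1 ℕ.≤ L → pow2inv M * (1ℚ - pow2inv L) ≢ bar η
pow2inv*[1-pow2inv]≢bar [] M L 1≤M η≤L 1≤L eq =
  ℚP.<-irrefl (sym eq) (*-pos (pow2inv-pos M) (p<q⇒0<q-p (pow2inv-strict {0} {L} 1≤L)))
pow2inv*[1-pow2inv]≢bar (b ∷ η) (suc M) L 1≤M η≤L 1≤L eq =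
  halved b M (½*-injective (trans (sym (ℚP.*-assoc ½ (pow2inv M) q)) eq))
  where
  open ℚP.≤-Reasoning
  q = 1ℚ - pow2inv L
  1-q≡p : 1ℚ - q ≡ pow2inv L
  1-q≡p = solve 1 (λ p → con 1ℚ :- (con 1ℚ :- p) := p) refl (pow2inv L)
  q≤1 : q ≤ 1ℚ
  q≤1 = ≤-byDifference (pow2inv L) 1-q≡p (pow2inv-nonNeg L)
  1≤1+bar : 1ℚ ≤ 1ℚ + bar η
  1≤1+bar = subst (_≤ 1ℚ + bar η) (ℚP.+-identityʳ 1ℚ) (ℚP.+-monoʳ-≤ 1ℚ (proj₁ (bar-In01 η)))
  halved : ∀ b M → pow2inv M * q ≢ bit b + bar η
  halved true zero eq′ = ℚP.<-irrefl eq′ (begin-strict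
    1ℚ * q      ≡⟨ ℚP.*-identityˡ q ⟩
    q           <⟨ 0<q-p⇒p<q (subst (0ℚ <_) (sym 1-q≡p) (pow2inv-pos L)) ⟩
    1ℚ          ≤⟨ 1≤1+bar ⟩
    1ℚ + bar η  ∎)
  halved false zero eq′ = ℚP.<-irrefl (sym eq′) (begin-strict
    0ℚ + bar η               ≡⟨ ℚP.+-identityˡ (bar η) ⟩
    bar η                    ≤⟨ bar≤1-pow2inv-length η ⟩
    1ℚ - pow2inv (length η)  <⟨ ℚP.+-monoʳ-< 1ℚ (ℚP.neg-antimono-< (pow2inv-strict η≤L)) ⟩
    q                        ≡⟨ ℚP.*-identityˡ q ⟨
    1ℚ * q                   ∎)
  halved true (suc M) eq′ = ℚP.<-irrefl eq′ (begin-strict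
    pow2inv (suc M) * q ≡⟨ ℚP.*-comm (pow2inv (suc M)) q ⟩
    q * pow2inv (suc M) ≤⟨ c≤1⇒c*p≤p q≤1 (pow2inv-nonNeg (suc M)) ⟩
    pow2inv (suc M)     ≤⟨ pow2inv-antitone {1} {suc M} (s≤s z≤n) ⟩
    ½                   <⟨ pow2inv-suc< 0 ⟩
    1ℚ                  ≤⟨ 1≤1+bar ⟩
    1ℚ + bar η          ∎)
  halved false (suc M) eq′ = pow2inv*[1-pow2inv]≢bar η (suc M) L (s≤s z≤n) (ℕP.≤-trans (ℕP.n≤1+n _) η≤L) 1≤L
    (trans eq′ (ℚP.+-identityˡ (bar η)))

pow2inv[T+M]*pow2[T] : ∀ {T M} → pow2inv (T ℕ.+ M) * pow2 T ≡ pow2inv M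
pow2inv[T+M]*pow2[T] {T} {M} = begin
  pow2inv (T ℕ.+ M) * pow2 T        ≡⟨ cong (_* pow2 T) (pow2inv-+ T M) ⟩
  (pow2inv T * pow2inv M) * pow2 T  ≡⟨ solve 3 (λ a b c → (a :* b) :* c := (a :* c) :* b) refl (pow2inv T) (pow2inv M) (pow2 T) ⟩
  (pow2inv T * pow2 T) * pow2inv M  ≡⟨ cong (_* pow2inv M) (pow2inv*pow2 T) ⟩
  1ℚ * pow2inv M                    ≡⟨ ℚP.*-identityˡ (pow2inv M) ⟩
  pow2inv M                         ∎
  where open ≡-Reasoning

¬Represents-pow2inv-short : ∀ τ η N → length τ ℕ.< N → ¬ Represents τ η (pow2inv N)
¬Represents-pow2inv-short τ [] N T<N r with bar≡0⊎pow2inv-length≤bar τ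
... | inj₁ bar≡0 = ℚP.<-irrefl (sym (trans r bar≡0)) (pow2inv-pos N)
... | inj₂ p≤bar = ℚP.<-irrefl refl (ℚP.<-≤-trans (pow2inv-strict T<N) (subst (pow2inv (length τ) ≤_) (sym r) p≤bar))
¬Represents-pow2inv-short τ (e ∷ η) N T<N r with bar≡0⊎pow2inv-length≤bar τ
... | inj₁ bar≡0 =
  pow2inv*[1-pow2inv]≢bar (e ∷ η) (N ℕ.∸ T) (suc (length η)) (ℕP.m<n⇒0<n∸m T<N) ℕP.≤-refl (s≤s z≤n)
    (trans (sym lhs) r)
  where
  T = length τ
  v = pow2inv N
  lhs : (v - bar τ) * pow2 T * (1ℚ - pow2inv (suc (length η))) ≡ pow2inv (N ℕ.∸ T) * (1ℚ - pow2inv (suc (length η)))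
  lhs = cong (_* (1ℚ - pow2inv (suc (length η)))) (begin
    (v - bar τ) * pow2 T                ≡⟨ cong (λ u → (v - u) * pow2 T) bar≡0 ⟩
    (v - 0ℚ) * pow2 T                   ≡⟨ cong (_* pow2 T) (solve 1 (λ v → v :- con 0ℚ := v) refl v) ⟩
    pow2inv N * pow2 T                  ≡⟨ cong (λ n → pow2inv n * pow2 T) (sym (ℕP.m+[n∸m]≡n (ℕP.<⇒≤ T<N))) ⟩
    pow2inv (T ℕ.+ (N ℕ.∸ T)) * pow2 T  ≡⟨ pow2inv[T+M]*pow2[T] {T} ⟩
    pow2inv (N ℕ.∸ T)                   ∎)
    where open ≡-Reasoning
... | inj₂ p≤bar = ℚP.<-irrefl refl (ℚP.≤-<-trans (proj₁ (bar-In01 (e ∷ η))) (subst (_< 0ℚ) r lhs<0))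
  where
  v = pow2inv N
  q = 1ℚ - pow2inv (suc (length η))
  0<rhs : 0ℚ < (bar τ - v) * pow2 (length τ) * q
  0<rhs = *-pos (*-pos (p<q⇒0<q-p (ℚP.<-≤-trans (pow2inv-strict T<N) p≤bar)) (pow2-pos (length τ)))
                (p<q⇒0<q-p (pow2inv-strict {0} {suc (length η)} (s≤s z≤n)))
  lhs<0 : (v - bar τ) * pow2 (length τ) * q < 0ℚ
  lhs<0 = subst (_< 0ℚ) (solve 4 (λ b v p q → :- ((b :- v) :* p :* q) := (v :- b) :* p :* q) refl (bar τ) v (pow2 (length τ)) q)
                (ℚP.neg-antimono-< 0<rhs)

Represents-pow2inv⇒≤length : ∀ τ η N → Represents τ η (pow2inv N) → N ℕ.≤ length τ
Represents-pow2inv⇒≤length τ η N r with N ℕ.≤? length τ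
... | yes N≤T = N≤T
... | no  N≰T = ⊥-elim (¬Represents-pow2inv-short τ η N (ℕP.≰⇒> N≰T) r)

-- The function

n<2^n : ∀ n → n ℕ.< 2 ^ n
n<2^n zero    = s≤s z≤n
n<2^n (suc n) = ℕP.<-≤-trans (s≤s (n<2^n n)) (1+m≤2*m (2 ^ n) (ℕP.m^n>0 2 n))
  where
  1+m≤2*m : ∀ m → 0 ℕ.< m → suc m ℕ.≤ 2 ℕ.* m
  1+m≤2*m m 0<m = begin
    suc m      ≡⟨ ℕP.+-comm 1 m ⟩
    m ℕ.+ 1    ≤⟨ ℕP.+-monoʳ-≤ m 0<m ⟩
    m ℕ.+ m    ≡⟨ cong (m ℕ.+_) (sym (ℕP.+-identityʳ m)) ⟩
    2 ℕ.* m    ∎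
    where open ℕP.≤-Reasoning

pow2inv-normalised : ∀ n → Σ ℕ λ d → pow2inv n ≡ mkℚ (+ 1) d (1-coprimeTo (suc d)) × suc d ≡ 2 ^ n
pow2inv-normalised zero = 0 , refl , refl
pow2inv-normalised (suc n) with pow2inv-normalised n
... | d , eq , 1+d≡2^n rewrite eq =
  d ℕ.+ suc (d ℕ.+ 0) , ℚP.normalize-coprime {1} {d ℕ.+ suc (d ℕ.+ 0)} (1-coprimeTo _) , cong (2 ℕ.*_) 1+d≡2^n

pow2inv-denominator≤ : ∀ x → 0ℚ < x → pow2inv (ℚ.↧ₙ x) ≤ x
pow2inv-denominator≤ (mkℚ (+ zero) d _)   (ℚ.*<* 0<0) = ⊥-elim (ℤP.<-irrefl refl 0<0)
pow2inv-denominator≤ (mkℚ -[1+ p ] d _)   (ℚ.*<* 0<n) = ⊥-elim (ℤP.<-asym 0<n ℤ.-<+)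
pow2inv-denominator≤ (mkℚ (+ suc p) d _) _ with pow2inv-normalised (suc d)
... | e , eq , 1+e≡2^[1+d] rewrite eq = ℚ.*≤* (+≤+ (begin
  1 ℕ.* suc d        ≡⟨ ℕP.*-identityˡ (suc d) ⟩
  suc d              ≤⟨ ℕP.<⇒≤ (subst (suc d ℕ.<_) (sym 1+e≡2^[1+d]) (n<2^n (suc d))) ⟩
  suc e              ≤⟨ ℕP.m≤n*m (suc e) (suc p) ⟩
  suc p ℕ.* suc e    ∎))
  where open ℕP.≤-Reasoning

findLevel : ℕ → ℕ → ℚ → ℕ
findLevel zero     j x = j
findLevel (suc fuel) j x with pow2inv (suc j) ≤? x
... | yes _ = j
... | no  _ = findLevel fuel (suc j) x

findLevel-correct : ∀ fuel j x → x < pow2inv j → pow2inv (j ℕ.+ fuel) ≤ x →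
  pow2inv (suc (findLevel fuel j x)) ≤ x × x < pow2inv (findLevel fuel j x)
findLevel-correct zero j x x<p p≤x =
  ⊥-elim (ℚP.<-irrefl refl (ℚP.<-≤-trans x<p (subst (λ n → pow2inv n ≤ x) (ℕP.+-identityʳ j) p≤x)))
findLevel-correct (suc fuel) j x x<p p≤x with pow2inv (suc j) ≤? x
... | yes p′≤x = p′≤x , x<p
... | no  p′≰x = findLevel-correct fuel (suc j) x (ℚP.≰⇒> p′≰x) (subst (λ n → pow2inv n ≤ x) (ℕP.+-suc j fuel) p≤x)

-- The i with 2^-(i+1) ≤ x < 2^-i; the denominator of x bounds the search.
level : ℚ → ℕ
level x = findLevel (ℚ.↧ₙ x) 0 x

InOpen01 : ℚ → Set
InOpen01 x = 0ℚ < x × x < 1ℚ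

inOpen01? : ∀ x → Dec (InOpen01 x)
inOpen01? x = (0ℚ <? x) ×-dec (x <? 1ℚ)

level-correct : ∀ {x} → InOpen01 x → pow2inv (suc (level x)) ≤ x × x < pow2inv (level x)
level-correct {x} (0<x , x<1) = findLevel-correct (ℚ.↧ₙ x) 0 x x<1 (pow2inv-denominator≤ x 0<x)

level-unique : ∀ {x i} → InOpen01 x → pow2inv (suc i) ≤ x → x < pow2inv i → level x ≡ i
level-unique {x} {i} x∈ p≤x x<p with level-correct x∈ | ℕP.<-cmp (level x) i
... | p′≤x , x<p′ | tri< l<i _ _ =
  ⊥-elim (ℚP.<-irrefl refl (ℚP.<-≤-trans x<p (ℚP.≤-trans (pow2inv-antitone l<i) p′≤x)))
... | _           | tri≈ _ l≡i _ = l≡i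
... | p′≤x , x<p′ | tri> _ _ i<l =
  ⊥-elim (ℚP.<-irrefl refl (ℚP.<-≤-trans x<p′ (ℚP.≤-trans (pow2inv-antitone i<l) p≤x)))

tent : ℕ → ℚ → ℚ
tent i x = (x - pow2inv (suc i)) ⊓ (pow2inv i - x)

tentsOn : (x : ℚ) → Dec (InOpen01 x) → ℚ
tentsOn x (yes _) = pow2inv (level x ℕ.* level x) * tent (level x) x
tentsOn x (no _)  = 0ℚ

tents : ℚ → ℚ
tents x = tentsOn x (inOpen01? x)

tents-inside : ∀ {x} → InOpen01 x → tents x ≡ pow2inv (level x ℕ.* level x) * tent (level x) x
tents-inside {x} x∈ with inOpen01? x
... | yes _  = refl
... | no x∉ = ⊥-elim (x∉ x∈)

intervalLo intervalHi : (x : ℚ) → Dec (InOpen01 x) → ℚ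
intervalLo x (yes _) = pow2inv (suc (level x))
intervalLo x (no _)  = x
intervalHi x (yes _) = pow2inv (level x)
intervalHi x (no _)  = x

record TentBounds (x : ℚ) (d : Dec (InOpen01 x)) : Set where
  field
    nonNeg : 0ℚ ≤ tentsOn x d
    ≤x-lo  : tentsOn x d ≤ x - intervalLo x d
    ≤hi-x  : tentsOn x d ≤ intervalHi x d - x
    lo≤x   : intervalLo x d ≤ x
    x≤hi   : x ≤ intervalHi x d

tentBounds : ∀ x d → TentBounds x d
tentBounds x (no _) = record
  { nonNeg = ℚP.≤-refl
  ; ≤x-lo = ℚP.≤-reflexive (sym (ℚP.+-inverseʳ x))
  ; ≤hi-x = ℚP.≤-reflexive (sym (ℚP.+-inverseʳ x))
  ; lo≤x = ℚP.≤-refl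
  ; x≤hi = ℚP.≤-refl }
tentBounds x (yes x∈) = record
  { nonNeg = *-nonNeg (pow2inv-nonNeg (i ℕ.* i)) 0≤tent
  ; ≤x-lo = ℚP.≤-trans scaled≤tent (ℚP.p⊓q≤p (x - pow2inv (suc i)) (pow2inv i - x))
  ; ≤hi-x = ℚP.≤-trans scaled≤tent (ℚP.p⊓q≤q (x - pow2inv (suc i)) (pow2inv i - x))
  ; lo≤x = proj₁ (level-correct x∈) ; x≤hi = ℚP.<⇒≤ (proj₂ (level-correct x∈)) }
  where
  i = level x
  0≤tent : 0ℚ ≤ tent i x
  0≤tent = ℚP.⊓-glb (p≤q⇒0≤q-p (proj₁ (level-correct x∈))) (p≤q⇒0≤q-p (ℚP.<⇒≤ (proj₂ (level-correct x∈))))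
  scaled≤tent : pow2inv (i ℕ.* i) * tent i x ≤ tent i x
  scaled≤tent = c≤1⇒c*p≤p (pow2inv≤1 (i ℕ.* i)) 0≤tent

tents-In01 : ∀ x → In01 (tents x)
tents-In01 x = TentBounds.nonNeg bounds , ≤1 (inOpen01? x) (TentBounds.≤hi-x bounds)
  where
  bounds = tentBounds x (inOpen01? x)
  ≤1 : ∀ d → tentsOn x d ≤ intervalHi x d - x → tentsOn x d ≤ 1ℚ
  ≤1 (yes (0<x , _)) f≤hi-x = ℚP.≤-trans f≤hi-x (ℚP.≤-trans
    (≤-byDifference x (solve 2 (λ h x → h :- (h :- x) := x) refl (pow2inv (level x)) x) (ℚP.<⇒≤ 0<x))
    (pow2inv≤1 (level x)))
  ≤1 (no _) _ = 0≤1

sameLevel⊎separated : ∀ {x y} → x ≤ y →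
  (InOpen01 x × InOpen01 y × level x ≡ level y) ⊎ intervalHi x (inOpen01? x) ≤ intervalLo y (inOpen01? y)
sameLevel⊎separated {x} {y} x≤y with inOpen01? x | inOpen01? y
... | yes x∈ | yes y∈ with ℕP.<-cmp (level x) (level y)
...   | tri≈ _ eq _  = inj₁ (x∈ , y∈ , eq)
...   | tri> _ _ j<i = inj₂ (pow2inv-antitone j<i)
...   | tri< i<j _ _ = ⊥-elim (ℚP.<-irrefl refl (ℚP.<-≤-trans (proj₂ (level-correct y∈))
                          (ℚP.≤-trans (pow2inv-antitone i<j) (ℚP.≤-trans (proj₁ (level-correct x∈)) x≤y))))
sameLevel⊎separated {x} {y} x≤y | yes (0<x , _) | no y∉ with y <? 1ℚ
... | yes y<1 = ⊥-elim (y∉ (ℚP.<-≤-trans 0<x x≤y , y<1))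
... | no  y≮1 = inj₂ (ℚP.≤-trans (pow2inv≤1 (level x)) (ℚP.≮⇒≥ y≮1))
sameLevel⊎separated {x} {y} x≤y | no x∉ | yes (_ , y<1) with 0ℚ <? x
... | yes 0<x = ⊥-elim (x∉ (0<x , ℚP.≤-<-trans x≤y y<1))
... | no  0≮x = inj₂ (ℚP.≤-trans (ℚP.≮⇒≥ 0≮x) (pow2inv-nonNeg (suc (level y))))
sameLevel⊎separated {x} {y} x≤y | no _ | no _ = inj₂ x≤y

-- Each value lies under the tent of its own interval, and the intervals do not overlap.
separated⇒lipschitz : ∀ {x y} dx dy → intervalHi x dx ≤ intervalLo y dy → ∣ tentsOn x dx - tentsOn y dy ∣ ≤ y - x
separated⇒lipschitz {x} {y} dx dy hi≤lo = -q≤p≤q⇒∣p∣≤q lower upper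
  where
  open TentBounds
  bx = tentBounds x dx
  by = tentBounds y dy
  fx = tentsOn x dx
  fy = tentsOn y dy
  h = intervalHi x dx
  l = intervalLo y dy
  upper : fx - fy ≤ y - x
  upper = ≤-byDifference (((h - x) - fx) + ((l - h) + ((y - l) + fy)))
    (solve 6 (λ fx fy x y h l → (y :- x) :- (fx :- fy) := ((h :- x) :- fx) :+ ((l :- h) :+ ((y :- l) :+ fy)))
       refl fx fy x y h l)
    (+-nonNeg (p≤q⇒0≤q-p (≤hi-x bx)) (+-nonNeg (p≤q⇒0≤q-p hi≤lo) (+-nonNeg (p≤q⇒0≤q-p (lo≤x by)) (nonNeg by))))
  lower : - (y - x) ≤ fx - fy
  lower = ≤-byDifference (fx + (((y - l) - fy) + ((l - h) + (h - x))))
    (solve 6 (λ fx fy x y h l → (fx :- fy) :- (:- (y :- x)) := fx :+ (((y :- l) :- fy) :+ ((l :- h) :+ (h :- x))))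
       refl fx fy x y h l)
    (+-nonNeg (nonNeg bx) (+-nonNeg (p≤q⇒0≤q-p (≤x-lo by)) (+-nonNeg (p≤q⇒0≤q-p hi≤lo) (p≤q⇒0≤q-p (x≤hi bx)))))

p-e≤q⇐p≤q+e : ∀ {p q e} → p ≤ q + e → p - e ≤ q
p-e≤q⇐p≤q+e {p} {q} {e} p≤q+e =
  ≤-byDifference ((q + e) - p) (solve 3 (λ p q e → q :- (p :- e) := (q :+ e) :- p) refl p q e) (p≤q⇒0≤q-p p≤q+e)

⊓-≤-+ : ∀ u v u′ v′ e → u ≤ u′ + e → v ≤ v′ + e → u ⊓ v ≤ (u′ ⊓ v′) + e
⊓-≤-+ u v u′ v′ e u≤ v≤ = ≤-byDifference ((u′ ⊓ v′) - ((u ⊓ v) - e))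
  (solve 3 (λ M m e → (M :+ e) :- m := M :- (m :- e)) refl (u′ ⊓ v′) (u ⊓ v) e)
  (p≤q⇒0≤q-p (ℚP.⊓-glb (p-e≤q⇐p≤q+e {u ⊓ v} {u′} {e} (ℚP.≤-trans (ℚP.p⊓q≤p u v) u≤))
                       (p-e≤q⇐p≤q+e {u ⊓ v} {v′} {e} (ℚP.≤-trans (ℚP.p⊓q≤q u v) v≤))))

tent-lipschitz : ∀ i {x y} → x ≤ y → ∣ tent i x - tent i y ∣ ≤ y - x
tent-lipschitz i {x} {y} x≤y = -q≤p≤q⇒∣p∣≤q
  (≤-byDifference (tent i x + d - tent i y)
    (solve 3 (λ mx my d → (mx :- my) :- (:- d) := mx :+ d :- my) refl (tent i x) (tent i y) d) (p≤q⇒0≤q-p y≤x+d))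
  (≤-byDifference (tent i y + d - tent i x)
    (solve 3 (λ mx my d → d :- (mx :- my) := my :+ d :- mx) refl (tent i x) (tent i y) d) (p≤q⇒0≤q-p x≤y+d))
  where
  a = pow2inv (suc i)
  b = pow2inv i
  d = y - x
  0≤d = p≤q⇒0≤q-p x≤y
  x≤y+d : tent i x ≤ tent i y + d
  x≤y+d = ⊓-≤-+ (x - a) (b - x) (y - a) (b - y) d
    (≤-byDifference (d + d) (solve 3 (λ x y a → ((y :- a) :+ (y :- x)) :- (x :- a) := (y :- x) :+ (y :- x)) refl x y a)
      (+-nonNeg 0≤d 0≤d))
    (≤-byDifference 0ℚ (solve 3 (λ x y b → ((b :- y) :+ (y :- x)) :- (b :- x) := con 0ℚ) refl x y b) ℚP.≤-refl)
  y≤x+d : tent i y ≤ tent i x + d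
  y≤x+d = ⊓-≤-+ (y - a) (b - y) (x - a) (b - x) d
    (≤-byDifference 0ℚ (solve 3 (λ x y a → ((x :- a) :+ (y :- x)) :- (y :- a) := con 0ℚ) refl x y a) ℚP.≤-refl)
    (≤-byDifference (d + d) (solve 3 (λ x y b → ((b :- x) :+ (y :- x)) :- (b :- y) := (y :- x) :+ (y :- x)) refl x y b)
      (+-nonNeg 0≤d 0≤d))

scaled-tent-lipschitz : ∀ c i {x y} → 0ℚ ≤ c → c ≤ 1ℚ → x ≤ y → ∣ c * tent i x - c * tent i y ∣ ≤ y - x
scaled-tent-lipschitz c i {x} {y} 0≤c c≤1 x≤y = begin
  ∣ c * tent i x - c * tent i y ∣ ≡⟨ cong ∣_∣ (solve 3 (λ c u v → c :* u :- c :* v := c :* (u :- v)) refl c _ _) ⟩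
  ∣ c * (tent i x - tent i y) ∣   ≡⟨ ℚP.∣p*q∣≡∣p∣*∣q∣ c _ ⟩
  ∣ c ∣ * ∣ tent i x - tent i y ∣ ≡⟨ cong (_* ∣ tent i x - tent i y ∣) (ℚP.0≤p⇒∣p∣≡p 0≤c) ⟩
  c * ∣ tent i x - tent i y ∣     ≤⟨ c≤1⇒c*p≤p c≤1 (ℚP.0≤∣p∣ _) ⟩
  ∣ tent i x - tent i y ∣         ≤⟨ tent-lipschitz i x≤y ⟩
  y - x                           ∎
  where open ℚP.≤-Reasoning

tents-lipschitz≤ : ∀ {x y} → x ≤ y → ∣ tents x - tents y ∣ ≤ y - x
tents-lipschitz≤ {x} {y} x≤y with sameLevel⊎separated x≤y
... | inj₂ hi≤lo = separated⇒lipschitz (inOpen01? x) (inOpen01? y) hi≤lo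
... | inj₁ (x∈ , y∈ , same) =
  subst (λ u → u ≤ y - x) (cong₂ (λ u v → ∣ u - v ∣) (sym (tents-inside x∈)) (sym (trans (tents-inside y∈) fy≡)))
    (scaled-tent-lipschitz (pow2inv (i ℕ.* i)) i (pow2inv-nonNeg (i ℕ.* i)) (pow2inv≤1 (i ℕ.* i)) x≤y)
  where
  i = level x
  fy≡ : pow2inv (level y ℕ.* level y) * tent (level y) y ≡ pow2inv (i ℕ.* i) * tent i y
  fy≡ = cong (λ l → pow2inv (l ℕ.* l) * tent l y) (sym same)

tents-lipschitz : LipschitzOn01 tents
tents-lipschitz = 1ℚ , λ x y _ _ → subst (∣ tents x - tents y ∣ ≤_) (sym (ℚP.*-identityˡ ∣ x - y ∣)) (bound x y)
  where
  bound : ∀ x y → ∣ tents x - tents y ∣ ≤ ∣ x - y ∣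
  bound x y with ℚP.≤-total x y
  ... | inj₁ x≤y = subst (∣ tents x - tents y ∣ ≤_) (sym (p≤q⇒∣p-q∣≡q-p x≤y)) (tents-lipschitz≤ x≤y)
  ... | inj₂ y≤x = subst₂ _≤_ (∣p-q∣≡∣q-p∣ (tents y) (tents x))
                     (trans (sym (p≤q⇒∣p-q∣≡q-p y≤x)) (∣p-q∣≡∣q-p∣ y x)) (tents-lipschitz≤ y≤x)

tentMapPrefix : List Bool → List Bool
tentMapPrefix []          = []
tentMapPrefix (false ∷ b) = b
tentMapPrefix (true ∷ b)  = map not b

tentMapRepeat : List Bool → Bool
tentMapRepeat []          = false
tentMapRepeat (false ∷ _) = false
tentMapRepeat (true ∷ _)  = true

min[y,1-y]≡½*tentMap : ∀ b → bar b ⊓ (1ℚ - bar b) ≡ ½ * expansionValue (tentMapPrefix b) (tentMapRepeat b)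
min[y,1-y]≡½*tentMap [] = refl
min[y,1-y]≡½*tentMap (false ∷ b) = begin
  y ⊓ (1ℚ - y)  ≡⟨ ℚP.p≤q⇒p⊓q≡p y≤1-y ⟩
  y             ≡⟨ solve 1 (λ z → con ½ :* (con 0ℚ :+ z) := con ½ :* z) refl (bar b) ⟩
  ½ * bar b     ≡⟨ cong (½ *_) (expansionValue-false b) ⟨
  ½ * expansionValue b false ∎
  where
  open ≡-Reasoning
  y = ½ * (0ℚ + bar b)
  y≤1-y : y ≤ 1ℚ - y
  y≤1-y = ≤-byDifference (1ℚ - bar b)
    (solve 1 (λ z → (con 1ℚ :- con ½ :* (con 0ℚ :+ z)) :- con ½ :* (con 0ℚ :+ z) := con 1ℚ :- z) refl (bar b))
    (p≤q⇒0≤q-p (proj₂ (bar-In01 b)))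
min[y,1-y]≡½*tentMap (true ∷ b) = begin
  y ⊓ (1ℚ - y)       ≡⟨ ℚP.p≥q⇒p⊓q≡q 1-y≤y ⟩
  1ℚ - y             ≡⟨ solve 1 (λ z → con 1ℚ :- con ½ :* (con 1ℚ :+ z) := con ½ :* (con 1ℚ :- z)) refl (bar b) ⟩
  ½ * (1ℚ - bar b)   ≡⟨ cong (½ *_) (expansionValue-not b) ⟨
  ½ * expansionValue (map not b) true ∎
  where
  open ≡-Reasoning
  y = ½ * (1ℚ + bar b)
  1-y≤y : 1ℚ - y ≤ y
  1-y≤y = ≤-byDifference (bar b)
    (solve 1 (λ z → con ½ :* (con 1ℚ :+ z) :- (con 1ℚ :- con ½ :* (con 1ℚ :+ z)) := z) refl (bar b))
    (proj₁ (bar-In01 b))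

leadingZeros : ℕ → ℕ
leadingZeros i = i ℕ.* suc i ℕ.+ 1

leadingZeros≡i*i+[1+i] : ∀ i → leadingZeros i ≡ i ℕ.* i ℕ.+ suc i
leadingZeros≡i*i+[1+i] i = begin
  i ℕ.* suc i ℕ.+ 1      ≡⟨ cong (ℕ._+ 1) (ℕP.*-suc i i) ⟩
  i ℕ.+ i ℕ.* i ℕ.+ 1    ≡⟨ cong (ℕ._+ 1) (ℕP.+-comm i (i ℕ.* i)) ⟩
  i ℕ.* i ℕ.+ i ℕ.+ 1    ≡⟨ ℕP.+-assoc (i ℕ.* i) i 1 ⟩
  i ℕ.* i ℕ.+ (i ℕ.+ 1)  ≡⟨ cong (i ℕ.* i ℕ.+_) (ℕP.+-comm i 1) ⟩
  i ℕ.* i ℕ.+ suc i      ∎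
  where open ≡-Reasoning

-- The point is 2^-i (1 + y)/2 with y = bar b, where the tent has height
-- 2^-(i² + i + 1) min (y, 1 - y), and 2 min (y, 1 - y) is the tent map at y.
tents-zeros++1∷ : ∀ i b → tents (bar (replicate i false ++ true ∷ b))
  ≡ expansionValue (replicate (leadingZeros i) false ++ false ∷ tentMapPrefix b) (tentMapRepeat b)
tents-zeros++1∷ i b = begin
  tents x
    ≡⟨ tents-inside x∈ ⟩
  pow2inv (level x ℕ.* level x) * tent (level x) x
    ≡⟨ cong (λ l → pow2inv (l ℕ.* l) * tent l x) level≡i ⟩
  c * ((x - P) ⊓ (B - x))
    ≡⟨ cong (c *_) (cong₂ _⊓_ x-P≡ B-x≡) ⟩
  c * ((P * y) ⊓ (P * (1ℚ - y)))
    ≡⟨ cong (c *_) (ℚP.*-distribˡ-⊓-nonNeg P {{ℚ.nonNegative (pow2inv-nonNeg (suc i))}} y (1ℚ - y)) ⟨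
  c * (P * (y ⊓ (1ℚ - y)))
    ≡⟨ cong (λ u → c * (P * u)) (min[y,1-y]≡½*tentMap b) ⟩
  c * (P * (½ * v))
    ≡⟨ solve 3 (λ c p v → c :* (p :* (con ½ :* v)) := (c :* p) :* (con ½ :* (con 0ℚ :+ v))) refl c P v ⟩
  (c * P) * (½ * (0ℚ + v))
    ≡⟨ cong (_* (½ * (0ℚ + v))) c*P≡ ⟩
  pow2inv (leadingZeros i) * expansionValue (false ∷ tentMapPrefix b) (tentMapRepeat b)
    ≡⟨ expansionValue-zeros++ (leadingZeros i) (false ∷ tentMapPrefix b) (tentMapRepeat b) ⟨
  expansionValue (replicate (leadingZeros i) false ++ false ∷ tentMapPrefix b) (tentMapRepeat b) ∎
  where
  open ≡-Reasoning
  y = bar b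
  P = pow2inv (suc i)
  B = pow2inv i
  c = pow2inv (i ℕ.* i)
  v = expansionValue (tentMapPrefix b) (tentMapRepeat b)
  x = bar (replicate i false ++ true ∷ b)
  c*P≡ : c * P ≡ pow2inv (leadingZeros i)
  c*P≡ = sym (trans (cong pow2inv (leadingZeros≡i*i+[1+i] i)) (pow2inv-+ (i ℕ.* i) (suc i)))
  x≡ : x ≡ B * (½ * (1ℚ + y))
  x≡ = bar-zeros++ i (true ∷ b)
  x-P≡ : x - P ≡ P * y
  x-P≡ = trans (cong (_- P) x≡)
    (solve 2 (λ B y → B :* (con ½ :* (con 1ℚ :+ y)) :- con ½ :* B := (con ½ :* B) :* y) refl B y)
  B-x≡ : B - x ≡ P * (1ℚ - y)
  B-x≡ = trans (cong (λ u → B - u) x≡)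
    (solve 2 (λ B y → B :- B :* (con ½ :* (con 1ℚ :+ y)) := (con ½ :* B) :* (con 1ℚ :- y)) refl B y)
  P≤x : P ≤ x
  P≤x = 0≤q-p⇒p≤q (subst (0ℚ ≤_) (sym x-P≡) (*-nonNeg (pow2inv-nonNeg (suc i)) (proj₁ (bar-In01 b))))
  x<B : x < B
  x<B = 0<q-p⇒p<q (subst (0ℚ <_) (sym B-x≡) (*-pos (pow2inv-pos (suc i)) (p<q⇒0<q-p (bar<1 b))))
  x∈ : InOpen01 x
  x∈ = ℚP.<-≤-trans (pow2inv-pos (suc i)) P≤x , ℚP.<-≤-trans x<B (pow2inv≤1 i)
  level≡i : level x ≡ i
  level≡i = level-unique x∈ P≤x x<B

-- The machine

Sy : Set
Sy = Sym 0

pattern ␣ = zero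
pattern 𝟎 = suc zero
pattern 𝟏 = suc (suc zero)
pattern ♯ = suc (suc (suc zero))

-- Visibly non-blank even for an unknown bit, unlike encBit.
bitSym : Bool → Sy
bitSym b = suc (if b then suc zero else zero)

map-bitSym : ∀ w → map bitSym w ≡ enc w
map-bitSym []          = refl
map-bitSym (false ∷ w) = cong (𝟎 ∷_) (map-bitSym w)
map-bitSym (true ∷ w)  = cong (𝟏 ∷_) (map-bitSym w)

pattern sweepRight      = zero
pattern sweepLeft       = suc zero
pattern firstTailBit    = suc (suc zero)
pattern copyBits        = suc (suc (suc zero))
pattern copyNegatedBits = suc (suc (suc (suc zero)))

Phase : Set
Phase = Fin 5

pattern countZeros = zero
pattern copyTail   = suc zero
pattern rewindTail = suc (suc zero)
pattern halted     = suc (suc (suc zero))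
pattern emit t     = suc (suc (suc (suc t)))

State : Set
State = Fin 9

record PhaseStep : Set where
  constructor phaseStep
  field
    bitOut             : Bool
    nextPhase          : Phase
    writeA writeB writeC : Sy
    moveA moveB moveC  : Move
open PhaseStep public

-- Tape A holds i ones and its head sweeps across them, emitting a 0 per step; each
-- completed sweep moves the head of B, which also holds i ones, one cell left, so
-- i (i + 1) + 1 zeros are emitted before the digits of the tail.
sweepRightStep sweepLeftStep firstTailBitStep copyBitsStep copyNegatedBitsStep : Sy → Sy → Sy → PhaseStep
sweepRightStep ␣ ␣ c       = phaseStep false firstTailBit ␣ ␣ c stay stay stay
sweepRightStep ␣ (suc b) c = phaseStep false sweepLeft ␣ (suc b) c left left stay
sweepRightStep (suc a) b c = phaseStep false sweepRight (suc a) b c right stay stay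

sweepLeftStep ␣ ␣ c       = phaseStep false firstTailBit ␣ ␣ c stay stay stay
sweepLeftStep ␣ (suc b) c = phaseStep false sweepRight ␣ (suc b) c right left stay
sweepLeftStep (suc a) b c = phaseStep false sweepLeft (suc a) b c left stay stay

firstTailBitStep a b 𝟏 = phaseStep false copyNegatedBits a b 𝟏 stay stay right
firstTailBitStep a b ␣ = phaseStep false copyBits a b ␣ stay stay right
firstTailBitStep a b 𝟎 = phaseStep false copyBits a b 𝟎 stay stay right
firstTailBitStep a b ♯ = phaseStep false copyBits a b ♯ stay stay right

copyBitsStep a b ␣ = phaseStep false copyBits a b ␣ stay stay stay
copyBitsStep a b 𝟎 = phaseStep false copyBits a b 𝟎 stay stay right
copyBitsStep a b 𝟏 = phaseStep true  copyBits a b 𝟏 stay stay right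
copyBitsStep a b ♯ = phaseStep false copyBits a b ♯ stay stay right

copyNegatedBitsStep a b ␣ = phaseStep true  copyNegatedBits a b ␣ stay stay stay
copyNegatedBitsStep a b 𝟎 = phaseStep true  copyNegatedBits a b 𝟎 stay stay right
copyNegatedBitsStep a b 𝟏 = phaseStep false copyNegatedBits a b 𝟏 stay stay right
copyNegatedBitsStep a b ♯ = phaseStep false copyNegatedBits a b ♯ stay stay right

phaseStepOf : Phase → Sy → Sy → Sy → PhaseStep
phaseStepOf sweepRight      = sweepRightStep
phaseStepOf sweepLeft       = sweepLeftStep
phaseStepOf firstTailBit    = firstTailBitStep
phaseStepOf copyBits        = copyBitsStep
phaseStepOf copyNegatedBits = copyNegatedBitsStep

Transition : Set
Transition = State × Vec Sy 5 × Vec Move 5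

transition : State → Sy → Sy → Sy → Sy → Sy → Move → Move → Move → Move → Move → Transition
transition s i o a b c mi mo ma mb mc = s , (i ∷ o ∷ a ∷ b ∷ c ∷ []) , (mi ∷ mo ∷ ma ∷ mb ∷ mc ∷ [])

haltHere : Sy → Sy → Sy → Sy → Sy → Transition
haltHere i o a b c = transition halted i o a b c stay stay stay stay stay

-- Tapes: input, output, A, B, C.  Leading zeros of σ are counted onto A and B,
-- the rest of σ after its first 1 is copied to C, and then one output bit is
-- emitted per input symbol from ♯ onwards, so that ♯1ⁿ yields n + 1 bits.
countZerosStep copyTailStep rewindTailStep : Sy → Sy → Sy → Sy → Sy → Transition
countZerosStep 𝟎 o a b c = transition countZeros 𝟎 o 𝟏 𝟏 c right stay right right stay
countZerosStep 𝟏 o a b c = transition copyTail 𝟏 o a b c right stay stay left stay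
countZerosStep ␣ o a b c = haltHere ␣ o a b c
countZerosStep ♯ o a b c = haltHere ♯ o a b c

copyTailStep 𝟎 o a b c = transition copyTail 𝟎 o a b 𝟎 right stay stay stay right
copyTailStep 𝟏 o a b c = transition copyTail 𝟏 o a b 𝟏 right stay stay stay right
copyTailStep ␣ o a b c = haltHere ␣ o a b c
copyTailStep ♯ o a b c = transition rewindTail ♯ o a b c stay stay stay stay left

rewindTailStep i o a b ␣       = transition (emit sweepRight) i o a b ␣ stay stay stay stay right
rewindTailStep i o a b (suc c) = transition rewindTail i o a b (suc c) stay stay stay stay left

emitStep : Phase → Sy → Sy → Sy → Sy → Sy → Transition
emitStep t ␣       o a b c = haltHere ␣ o a b c
emitStep t (suc x) o a b c =
  emit (nextPhase r) , (suc x ∷ bitSym (bitOut r) ∷ writeA r ∷ writeB r ∷ writeC r ∷ []) ,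
  (right ∷ right ∷ moveA r ∷ moveB r ∷ moveC r ∷ [])
  where r = phaseStepOf t a b c

stepOf : State → Sy → Sy → Sy → Sy → Sy → Transition
stepOf countZeros = countZerosStep
stepOf copyTail   = copyTailStep
stepOf rewindTail = rewindTailStep
stepOf halted     = haltHere
stepOf (emit t)   = emitStep t

isHalted : State → Bool
isHalted halted = true
isHalted _      = false

machine : TM
machine = record
  { g = 0 ; k = 3 ; q = 9 ; start = countZeros ; halting = isHalted
  ; δ = λ { s (i ∷ o ∷ a ∷ b ∷ c ∷ []) → stepOf s i o a b c } }

open ZipperRun machine

Zip : Set
Zip = Zipper {0}

HaltsWriting : ZConfig → Zip → Set
HaltsWriting c Z = zstate c ≡ halted × Vec.lookup (zippers c) (suc zero) ≡ Z

record EmitConfig : Set where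
  constructor emitConfig
  field
    phase             : Phase
    tapeA tapeB tapeC : Zip
open EmitConfig public

advance : EmitConfig → Bool × EmitConfig
advance (emitConfig t A B C) =
  bitOut r , emitConfig (nextPhase r) (shift (moveA r) (overwrite A (writeA r)))
                                      (shift (moveB r) (overwrite B (writeB r)))
                                      (shift (moveC r) (overwrite C (writeC r)))
  where r = phaseStepOf t (focus A) (focus B) (focus C)

emitted : ℕ → EmitConfig → List Bool
emitted zero    _ = []
emitted (suc m) e = proj₁ (advance e) ∷ emitted m (proj₂ (advance e))

afterEmitting : ℕ → EmitConfig → EmitConfig
afterEmitting zero    e = e
afterEmitting (suc m) e = afterEmitting m (proj₂ (advance e))

sucⁿ : ℕ → ℤ → ℤ
sucⁿ zero    p = p
sucⁿ (suc n) p = sucⁿ n (ℤ.suc p)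

predⁿ : ℕ → ℤ → ℤ
predⁿ zero    p = p
predⁿ (suc n) p = predⁿ n (ℤ.pred p)

emit-run : ∀ r e x ls p outL q →
  HaltsWriting (zrun (suc (suc r)) (zconfig (emit (phase e))
                 (zipper ls (suc x) (replicate r 𝟏) p ∷ zipper outL ␣ [] q ∷ tapeA e ∷ tapeB e ∷ tapeC e ∷ [])))
               (zipper (map bitSym (emitted (suc r) e) ʳ++ outL) ␣ [] (sucⁿ (suc r) q))
emit-run zero    e x ls p outL q = refl , refl
emit-run (suc r) e x ls p outL q =
  emit-run r (proj₂ (advance e)) (suc zero) (suc x ∷ ls) (ℤ.suc p) (bitSym (proj₁ (advance e)) ∷ outL) (ℤ.suc q)

ReadyToEmit : ℕ → ZConfig → EmitConfig → Set
ReadyToEmit n c e = Σ (List Sy) λ ls → Σ ℤ λ p →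
  c ≡ zconfig (emit (phase e)) (zipper ls ♯ (replicate n 𝟏) p ∷ emptyZipper ∷ tapeA e ∷ tapeB e ∷ tapeC e ∷ [])

ready⇒haltsWriting : ∀ n c e → ReadyToEmit n c e →
  HaltsWriting (zrun (suc (suc n)) c) (zipper (map bitSym (emitted (suc n) e) ʳ++ []) ␣ [] (sucⁿ (suc n) (+ 0)))
ready⇒haltsWriting n c e (ls , p , refl) = emit-run n e (suc (suc zero)) ls p [] (+ 0)

-- Tail-recursive addition, so that i +′ K unfolds in step with a run that grows a counter.
_+′_ : ℕ → ℕ → ℕ
zero  +′ k = k
suc i +′ k = i +′ suc k

+′≡+ : ∀ i k → i +′ k ≡ i ℕ.+ k
+′≡+ zero    k = refl
+′≡+ (suc i) k = trans (+′≡+ i (suc k)) (ℕP.+-suc i k)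

onesHeadRight : ℕ → Zip
onesHeadRight K = zipper (replicate K 𝟏) ␣ [] (+ K)

-- j + r ones with the head on the j-th one, or just left of them when j = 0.
onesHeadAt : ℕ → ℕ → Zip
onesHeadAt zero    r = zipper [] ␣ (replicate r 𝟏) -[1+ 0 ]
onesHeadAt (suc j) r = zipper (replicate j 𝟏) 𝟏 (replicate r 𝟏) (+ j)

shift-onesHeadRight : ∀ K → shift left (overwrite (onesHeadRight K) ␣) ≡ onesHeadAt K 0
shift-onesHeadRight zero    = refl
shift-onesHeadRight (suc K) = refl

countZeros-run : ∀ i rest ls p K O C →
  zrun i (zconfig countZeros (zipper ls (headOrBlank (enc (replicate i false) ++ rest)) (drop 1 (enc (replicate i false) ++ rest)) p
                              ∷ O ∷ onesHeadRight K ∷ onesHeadRight K ∷ C ∷ []))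
  ≡ zconfig countZeros (zipper (replicate i 𝟎 ʳ++ ls) (headOrBlank rest) (drop 1 rest) (sucⁿ i p)
                        ∷ O ∷ onesHeadRight (i +′ K) ∷ onesHeadRight (i +′ K) ∷ C ∷ [])
countZeros-run zero    rest ls p K O C = refl
countZeros-run (suc i) rest ls p K O C = countZeros-run i rest (𝟎 ∷ ls) (ℤ.suc p) (suc K) O C

copyTail-run : ∀ b rest ls p O A B acc pc →
  zrun (length b) (zconfig copyTail (zipper ls (headOrBlank (enc b ++ rest)) (drop 1 (enc b ++ rest)) p ∷ O ∷ A ∷ B ∷
                                     zipper (enc acc) ␣ [] pc ∷ []))
  ≡ zconfig copyTail (zipper (enc b ʳ++ ls) (headOrBlank rest) (drop 1 rest) (sucⁿ (length b) p) ∷ O ∷ A ∷ B ∷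
                      zipper (enc (b ʳ++ acc)) ␣ [] (sucⁿ (length b) pc) ∷ [])
copyTail-run []          rest ls p O A B acc pc = refl
copyTail-run (false ∷ b) rest ls p O A B acc pc = copyTail-run b rest (𝟎 ∷ ls) (ℤ.suc p) O A B (false ∷ acc) (ℤ.suc pc)
copyTail-run (true ∷ b)  rest ls p O A B acc pc = copyTail-run b rest (𝟏 ∷ ls) (ℤ.suc p) O A B (true ∷ acc) (ℤ.suc pc)

rewindTail-run : ∀ v rs p I O A B →
  zrun (suc (length v)) (zconfig rewindTail (I ∷ O ∷ A ∷ B ∷ zipper (drop 1 (enc v)) (headOrBlank (enc v)) (enc rs) p ∷ []))
  ≡ zconfig (emit sweepRight) (I ∷ O ∷ A ∷ B ∷
      zipper [] (headOrBlank (enc (v ʳ++ rs))) (drop 1 (enc (v ʳ++ rs))) (ℤ.suc (predⁿ (length v) p)) ∷ [])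
rewindTail-run []          rs p I O A B = refl
rewindTail-run (false ∷ v) rs p I O A B = rewindTail-run v (false ∷ rs) (ℤ.pred p) I O A B
rewindTail-run (true ∷ v)  rs p I O A B = rewindTail-run v (true ∷ rs) (ℤ.pred p) I O A B

enc-zeros++1∷ : ∀ i b (X : List Sy) → enc (replicate i false ++ true ∷ b) ++ X ≡ enc (replicate i false) ++ 𝟏 ∷ enc b ++ X
enc-zeros++1∷ zero    b X = refl
enc-zeros++1∷ (suc i) b X = cong (𝟎 ∷_) (enc-zeros++1∷ i b X)

tailZipper : List Bool → ℤ → Zip
tailZipper b p = zipper [] (headOrBlank (enc b)) (drop 1 (enc b)) p

countZeros-phase : ∀ i rest →
  zrun (i ℕ.+ 1) (zinitial (enc (replicate i false) ++ 𝟏 ∷ rest))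
  ≡ zconfig copyTail (zipper (𝟏 ∷ replicate i 𝟎 ʳ++ []) (headOrBlank rest) (drop 1 rest) (ℤ.suc (sucⁿ i (+ 0)))
                      ∷ emptyZipper ∷ onesHeadRight (i +′ 0) ∷ onesHeadAt (i +′ 0) 0 ∷ emptyZipper ∷ [])
countZeros-phase i rest = begin
  zrun (i ℕ.+ 1) (zinitial (enc (replicate i false) ++ 𝟏 ∷ rest))
    ≡⟨ zrun-+ i 1 _ ⟩
  zrun 1 (zrun i (zinitial (enc (replicate i false) ++ 𝟏 ∷ rest)))
    ≡⟨ cong (zrun 1) (countZeros-run i (𝟏 ∷ rest) [] (+ 0) 0 emptyZipper emptyZipper) ⟩
  zconfig copyTail (I ∷ emptyZipper ∷ onesHeadRight K ∷ shift left (overwrite (onesHeadRight K) ␣) ∷ emptyZipper ∷ [])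
    ≡⟨ cong (λ B → zconfig copyTail (I ∷ emptyZipper ∷ onesHeadRight K ∷ B ∷ emptyZipper ∷ [])) (shift-onesHeadRight K) ⟩
  zconfig copyTail (I ∷ emptyZipper ∷ onesHeadRight K ∷ onesHeadAt K 0 ∷ emptyZipper ∷ []) ∎
  where
  open ≡-Reasoning
  K = i +′ 0
  I = zipper (𝟏 ∷ replicate i 𝟎 ʳ++ []) (headOrBlank rest) (drop 1 rest) (ℤ.suc (sucⁿ i (+ 0)))

copyTail-phase : ∀ b X ls p A B →
  zrun (length b ℕ.+ 1) (zconfig copyTail (zipper ls (headOrBlank (enc b ++ ♯ ∷ X)) (drop 1 (enc b ++ ♯ ∷ X)) p
                                           ∷ emptyZipper ∷ A ∷ B ∷ emptyZipper ∷ []))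
  ≡ zconfig rewindTail (zipper (enc b ʳ++ ls) ♯ X (sucⁿ (length b) p) ∷ emptyZipper ∷ A ∷ B
                        ∷ zipper (drop 1 (enc (b ʳ++ []))) (headOrBlank (enc (b ʳ++ []))) [] (ℤ.pred (sucⁿ (length b) (+ 0))) ∷ [])
copyTail-phase b X ls p A B =
  trans (zrun-+ (length b) 1 _) (cong (zrun 1) (copyTail-run b (♯ ∷ X) ls p emptyZipper A B [] (+ 0)))

prepTime : ℕ → ℕ → ℕ
prepTime i lb = i ℕ.+ 1 ℕ.+ (lb ℕ.+ 1 ℕ.+ suc lb)

reachEmit : ∀ i b n → Σ ℤ λ pc →
  ReadyToEmit n (zrun (prepTime i (length b)) (zinitial (enc (replicate i false ++ true ∷ b) ++ ♯ ∷ replicate n 𝟏)))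
                (emitConfig sweepRight (onesHeadRight (i +′ 0)) (onesHeadAt (i +′ 0) 0) (tailZipper b pc))
reachEmit i b n = _ , _ , _ , (begin
  zrun (prepTime i lb) (zinitial (enc (replicate i false ++ true ∷ b) ++ X))
    ≡⟨ cong (λ w → zrun (prepTime i lb) (zinitial w)) (enc-zeros++1∷ i b X) ⟩
  zrun (i ℕ.+ 1 ℕ.+ (lb ℕ.+ 1 ℕ.+ suc lb)) (zinitial (enc (replicate i false) ++ 𝟏 ∷ enc b ++ X))
    ≡⟨ zrun-+ (i ℕ.+ 1) _ _ ⟩
  zrun (lb ℕ.+ 1 ℕ.+ suc lb) (zrun (i ℕ.+ 1) (zinitial (enc (replicate i false) ++ 𝟏 ∷ enc b ++ X)))
    ≡⟨ cong (zrun (lb ℕ.+ 1 ℕ.+ suc lb)) (countZeros-phase i (enc b ++ X)) ⟩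
  zrun (lb ℕ.+ 1 ℕ.+ suc lb) Z₁
    ≡⟨ zrun-+ (lb ℕ.+ 1) (suc lb) Z₁ ⟩
  zrun (suc lb) (zrun (lb ℕ.+ 1) Z₁)
    ≡⟨ cong (zrun (suc lb)) (copyTail-phase b (replicate n 𝟏) _ _ (onesHeadRight K) (onesHeadAt K 0)) ⟩
  zrun (suc lb) Z₂
    ≡⟨ cong (λ l → zrun (suc l) Z₂) (sym length-V) ⟩
  zrun (suc (length V)) Z₂
    ≡⟨ rewindTail-run V [] _ I emptyZipper (onesHeadRight K) (onesHeadAt K 0) ⟩
  Z₃ (V ʳ++ [])
    ≡⟨ cong Z₃ (LP.reverse-involutive b) ⟩
  Z₃ b ∎)
  where
  open ≡-Reasoning
  K = i +′ 0
  X = ♯ ∷ replicate n 𝟏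
  lb = length b
  V = b ʳ++ []
  Z₁ Z₂ : ZConfig
  Z₁ = zconfig copyTail (zipper (𝟏 ∷ replicate i 𝟎 ʳ++ []) (headOrBlank (enc b ++ X)) (drop 1 (enc b ++ X)) (ℤ.suc (sucⁿ i (+ 0)))
                         ∷ emptyZipper ∷ onesHeadRight K ∷ onesHeadAt K 0 ∷ emptyZipper ∷ [])
  I = zipper (enc b ʳ++ 𝟏 ∷ replicate i 𝟎 ʳ++ []) ♯ (replicate n 𝟏) (sucⁿ lb (ℤ.suc (sucⁿ i (+ 0))))
  Z₂ = zconfig rewindTail (I ∷ emptyZipper ∷ onesHeadRight K ∷ onesHeadAt K 0 ∷
                           zipper (drop 1 (enc V)) (headOrBlank (enc V)) [] (ℤ.pred (sucⁿ lb (+ 0))) ∷ [])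
  Z₃ : List Bool → ZConfig
  Z₃ v = zconfig (emit sweepRight) (I ∷ emptyZipper ∷ onesHeadRight K ∷ onesHeadAt K 0 ∷
                                    tailZipper v (ℤ.suc (predⁿ (length V) (ℤ.pred (sucⁿ lb (+ 0))))) ∷ [])
  length-V : length V ≡ lb
  length-V = trans (LP.length-ʳ++ b) (ℕP.+-identityʳ lb)

run-on-zeros : ∀ m n → HaltsWriting (zrun (m ℕ.+ 1) (zinitial (enc (replicate m false) ++ ♯ ∷ replicate n 𝟏))) emptyZipper
run-on-zeros m n = subst (λ c → HaltsWriting c emptyZipper) (sym (trans (zrun-+ m 1 _)
  (cong (zrun 1) (countZeros-run m (♯ ∷ replicate n 𝟏) [] (+ 0) 0 emptyZipper emptyZipper)))) (refl , refl)

emitted-+ : ∀ a b e → emitted (a ℕ.+ b) e ≡ emitted a e ++ emitted b (afterEmitting a e)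
emitted-+ zero    b e = refl
emitted-+ (suc a) b e = cong (proj₁ (advance e) ∷_) (emitted-+ a b (proj₂ (advance e)))

afterEmitting-+ : ∀ a b e → afterEmitting (a ℕ.+ b) e ≡ afterEmitting b (afterEmitting a e)
afterEmitting-+ zero    b e = refl
afterEmitting-+ (suc a) b e = afterEmitting-+ a b (proj₂ (advance e))

length-emitted : ∀ m e → length (emitted m e) ≡ m
length-emitted zero    e = refl
length-emitted (suc m) e = cong suc (length-emitted m (proj₂ (advance e)))

replicate-+ : ∀ {A : Set} a b (x : A) → replicate (a ℕ.+ b) x ≡ replicate a x ++ replicate b x
replicate-+ zero    b x = refl
replicate-+ (suc a) b x = cong (x ∷_) (replicate-+ a b x)

EmitsZeros : ℕ → EmitConfig → EmitConfig → Set
EmitsZeros N e e′ = afterEmitting N e ≡ e′ × emitted N e ≡ replicate N false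

EmitsZeros-trans : ∀ {a b e e′ e″} → EmitsZeros a e e′ → EmitsZeros b e′ e″ → EmitsZeros (a ℕ.+ b) e e″
EmitsZeros-trans {a} {b} {e} (after-a , zeros-a) (after-b , zeros-b) =
  trans (afterEmitting-+ a b e) (trans (cong (afterEmitting b) after-a) after-b) ,
  trans (emitted-+ a b e) (trans (cong₂ _++_ zeros-a (trans (cong (emitted b) after-a) zeros-b)) (sym (replicate-+ a b false)))

sweepLeft-emits : ∀ k r B C →
  EmitsZeros (suc k) (emitConfig sweepLeft (onesHeadAt (suc k) r) B C) (emitConfig sweepLeft (onesHeadAt 0 (k +′ suc r)) B C)
sweepLeft-emits zero    r B C = refl , refl
sweepLeft-emits (suc k) r B C = proj₁ ih , cong (false ∷_) (proj₂ ih)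
  where ih = sweepLeft-emits k (suc r) B C

sweepRight-emits : ∀ r k B C →
  EmitsZeros (suc r) (emitConfig sweepRight (onesHeadAt (suc k) r) B C) (emitConfig sweepRight (onesHeadRight (r +′ suc k)) B C)
sweepRight-emits zero    k B C = refl , refl
sweepRight-emits (suc r) k B C = proj₁ ih , cong (false ∷_) (proj₂ ih)
  where ih = sweepRight-emits r (suc k) B C

shift-onesHeadAt : ∀ j r → shift left (overwrite (onesHeadAt (suc j) r) 𝟏) ≡ onesHeadAt j (suc r)
shift-onesHeadAt zero    r = refl
shift-onesHeadAt (suc j) r = refl

sweeping : ℕ → Bool → ℕ → ℕ → Zip → EmitConfig
sweeping K true  j r C = emitConfig sweepRight (onesHeadRight K) (onesHeadAt j r) C
sweeping K false j r C = emitConfig sweepLeft (onesHeadAt 0 K) (onesHeadAt j r) C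

SweepsThenTail : ℕ → EmitConfig → Zip → Set
SweepsThenTail N e C = Σ Zip λ A′ → Σ Zip λ B′ → EmitsZeros N e (emitConfig firstTailBit A′ B′ C)

sweeping-done : ∀ K e r C → SweepsThenTail 1 (sweeping K e 0 r C) C
sweeping-done K true  r C = _ , _ , refl , refl
sweeping-done K false r C = _ , _ , refl , refl

+′1 : ∀ K → K +′ 1 ≡ suc K
+′1 K = trans (+′≡+ K 1) (ℕP.+-comm K 1)

sweeping-round : ∀ K e j r C →
  EmitsZeros (suc (suc K)) (sweeping (suc K) e (suc j) r C) (sweeping (suc K) (not e) j (suc r) C)
sweeping-round K true j r C =
  trans (proj₁ sweep) (cong₂ (λ n B → emitConfig sweepLeft (onesHeadAt 0 n) B C) (+′1 K) (shift-onesHeadAt j r)) ,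
  cong (false ∷_) (proj₂ sweep)
  where sweep = sweepLeft-emits K 0 (shift left (overwrite (onesHeadAt (suc j) r) 𝟏)) C
sweeping-round K false j r C =
  trans (proj₁ sweep) (cong₂ (λ n B → emitConfig sweepRight (onesHeadRight n) B C) (+′1 K) (shift-onesHeadAt j r)) ,
  cong (false ∷_) (proj₂ sweep)
  where sweep = sweepRight-emits K 0 (shift left (overwrite (onesHeadAt (suc j) r) 𝟏)) C

sweeping-rounds : ∀ K j e r C → SweepsThenTail (j ℕ.* suc (suc K) ℕ.+ 1) (sweeping (suc K) e j r C) C
sweeping-rounds K zero    e r C = sweeping-done (suc K) e r C
sweeping-rounds K (suc j) e r C with sweeping-rounds K j (not e) (suc r) C
... | A′ , B′ , rest = A′ , B′ ,
  subst (λ N → EmitsZeros N (sweeping (suc K) e (suc j) r C) (emitConfig firstTailBit A′ B′ C))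
        (sym (ℕP.+-assoc (suc (suc K)) (j ℕ.* suc (suc K)) 1))
        (EmitsZeros-trans {e = sweeping (suc K) e (suc j) r C} {e′ = sweeping (suc K) (not e) j (suc r) C}
                          (sweeping-round K e j r C) rest)

zeroPhase : ∀ K C → SweepsThenTail (leadingZeros K) (emitConfig sweepRight (onesHeadRight K) (onesHeadAt K 0) C) C
zeroPhase zero    C = sweeping-done zero true 0 C
zeroPhase (suc K) C = sweeping-rounds K (suc K) true 0 C

copyBits-emits : ∀ m w ls p A B →
  emitted m (emitConfig copyBits A B (zipper ls (headOrBlank (enc w)) (drop 1 (enc w)) p)) ≡ expansionPrefix m w false
copyBits-emits zero    w           ls p A B = refl
copyBits-emits (suc m) []          ls p A B = cong (false ∷_) (copyBits-emits m [] ls p A B)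
copyBits-emits (suc m) (false ∷ w) ls p A B = cong (false ∷_) (copyBits-emits m w (𝟎 ∷ ls) (ℤ.suc p) A B)
copyBits-emits (suc m) (true ∷ w)  ls p A B = cong (true ∷_) (copyBits-emits m w (𝟏 ∷ ls) (ℤ.suc p) A B)

copyNegatedBits-emits : ∀ m w ls p A B →
  emitted m (emitConfig copyNegatedBits A B (zipper ls (headOrBlank (enc w)) (drop 1 (enc w)) p)) ≡ expansionPrefix m (map not w) true
copyNegatedBits-emits zero    w           ls p A B = refl
copyNegatedBits-emits (suc m) []          ls p A B = cong (true ∷_) (copyNegatedBits-emits m [] ls p A B)
copyNegatedBits-emits (suc m) (false ∷ w) ls p A B = cong (true ∷_) (copyNegatedBits-emits m w (𝟎 ∷ ls) (ℤ.suc p) A B)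
copyNegatedBits-emits (suc m) (true ∷ w)  ls p A B = cong (false ∷_) (copyNegatedBits-emits m w (𝟏 ∷ ls) (ℤ.suc p) A B)

firstTailBit-emits : ∀ m b p A B →
  emitted m (emitConfig firstTailBit A B (tailZipper b p)) ≡ expansionPrefix m (false ∷ tentMapPrefix b) (tentMapRepeat b)
firstTailBit-emits zero    b           p A B = refl
firstTailBit-emits (suc m) []          p A B = cong (false ∷_) (copyBits-emits m [] [] (ℤ.suc p) A B)
firstTailBit-emits (suc m) (false ∷ b) p A B = cong (false ∷_) (copyBits-emits m b (𝟎 ∷ []) (ℤ.suc p) A B)
firstTailBit-emits (suc m) (true ∷ b)  p A B = cong (false ∷_) (copyNegatedBits-emits m b (𝟏 ∷ []) (ℤ.suc p) A B)

emitted-zeros++ : ∀ K e w c → emitted K e ≡ replicate K false → (∀ m → emitted m (afterEmitting K e) ≡ expansionPrefix m w c) →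
  ∀ m → emitted m e ≡ expansionPrefix m (replicate K false ++ w) c
emitted-zeros++ zero    e w c _     rest m       = rest m
emitted-zeros++ (suc K) e w c _     rest zero    = refl
emitted-zeros++ (suc K) e w c zeros rest (suc m) =
  cong₂ _∷_ (proj₁ (LP.∷-injective zeros)) (emitted-zeros++ K (proj₂ (advance e)) w c (proj₂ (LP.∷-injective zeros)) rest m)

emitted≡expansionPrefix : ∀ K b p m →
  emitted m (emitConfig sweepRight (onesHeadRight K) (onesHeadAt K 0) (tailZipper b p))
  ≡ expansionPrefix m (replicate (leadingZeros K) false ++ false ∷ tentMapPrefix b) (tentMapRepeat b)
emitted≡expansionPrefix K b p m with zeroPhase K (tailZipper b p)
... | A′ , B′ , after , zeros =
  emitted-zeros++ (leadingZeros K) _ _ _ zeros (λ m′ → trans (cong (emitted m′) after) (firstTailBit-emits m′ b p A′ B′)) m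

-- Linear time

sucⁿ-+ : ∀ k m → sucⁿ k (+ m) ≡ + (k ℕ.+ m)
sucⁿ-+ zero    m = refl
sucⁿ-+ (suc k) m = trans (sucⁿ-+ k (suc m)) (cong +_ (ℕP.+-suc k m))

haltsWriting⇒haltsWithin : ∀ w T t ρ → t ℕ.≤ T →
  HaltsWriting (zrun t (zinitial w)) (zipper (map bitSym ρ ʳ++ []) ␣ [] (+ length ρ)) → HaltsWithin machine w T (enc ρ)
haltsWriting⇒haltsWithin w T t ρ t≤T (halted≡ , output≡) =
  haltsWithin-zrun w T (enc ρ) t t≤T (cong isHalted halted≡)
    (subst (λ Z → Holds machine (contents Z) (+ 0) (enc ρ)) (sym output≡)
      (subst₂ (λ n u → Holds machine (contents (zipper (map bitSym ρ ʳ++ []) ␣ [] (+ n))) (+ 0) u)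
        (LP.length-map bitSym ρ) (map-bitSym ρ) (Holds-written machine (map bitSym ρ))))

zeros⊎zeros++1∷ : ∀ σ →
  (Σ ℕ λ m → σ ≡ replicate m false) ⊎ (Σ ℕ λ i → Σ (List Bool) λ b → σ ≡ replicate i false ++ true ∷ b)
zeros⊎zeros++1∷ []         = inj₁ (0 , refl)
zeros⊎zeros++1∷ (true ∷ σ) = inj₂ (0 , σ , refl)
zeros⊎zeros++1∷ (false ∷ σ) with zeros⊎zeros++1∷ σ
... | inj₁ (m , σ≡)     = inj₁ (suc m , cong (false ∷_) σ≡)
... | inj₂ (i , b , σ≡) = inj₂ (suc i , b , cong (false ∷_) σ≡)

length-zeros++1∷ : ∀ i b → length (replicate i false ++ true ∷ b) ≡ i ℕ.+ suc (length b)
length-zeros++1∷ i b = trans (LP.length-++ (replicate i false)) (cong (ℕ._+ suc (length b)) (LP.length-replicate i))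

time-zeros++1∷ : ∀ i lb n → prepTime i lb ℕ.+ suc (suc n) ℕ.≤ 6 ℕ.* (i ℕ.+ suc lb ℕ.+ n ℕ.+ 1)
time-zeros++1∷ i lb n =
  subst (prepTime i lb ℕ.+ suc (suc n) ℕ.≤_) (eq i lb n) (ℕP.m≤m+n _ (5 ℕ.* i ℕ.+ 4 ℕ.* lb ℕ.+ 5 ℕ.* n ℕ.+ 7))
  where
  eq : ∀ i lb n → i ℕ.+ 1 ℕ.+ (lb ℕ.+ 1 ℕ.+ suc lb) ℕ.+ suc (suc n) ℕ.+ (5 ℕ.* i ℕ.+ 4 ℕ.* lb ℕ.+ 5 ℕ.* n ℕ.+ 7)
                  ≡ 6 ℕ.* (i ℕ.+ suc lb ℕ.+ n ℕ.+ 1)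
  eq = solve-∀

time-zeros : ∀ m n → m ℕ.+ 1 ℕ.≤ 6 ℕ.* (m ℕ.+ n ℕ.+ 1)
time-zeros m n = subst (m ℕ.+ 1 ℕ.≤_) (eq m n) (ℕP.m≤m+n _ (5 ℕ.* m ℕ.+ 6 ℕ.* n ℕ.+ 5))
  where
  eq : ∀ m n → m ℕ.+ 1 ℕ.+ (5 ℕ.* m ℕ.+ 6 ℕ.* n ℕ.+ 5) ≡ 6 ℕ.* (m ℕ.+ n ℕ.+ 1)
  eq = solve-∀

ApproximatesWithin : ℕ → List Bool → ℕ → Set
ApproximatesWithin c σ n = Σ (List Bool) λ ρ →
  HaltsWithin machine (pairInput σ n) (c ℕ.* (length σ ℕ.+ n ℕ.+ 1)) (enc ρ) × ∣ bar ρ - tents (bar σ) ∣ < pow2inv n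

approximates-zeros : ∀ m n → ApproximatesWithin 6 (replicate m false) n
approximates-zeros m n =
  [] , haltsWriting⇒haltsWithin (pairInput (replicate m false) n) _ (m ℕ.+ 1) [] time≤ (run-on-zeros m n) ,
  subst (λ x → ∣ 0ℚ - tents x ∣ < pow2inv n) (sym (bar-zeros m)) (pow2inv-pos n)
  where
  time≤ : m ℕ.+ 1 ℕ.≤ 6 ℕ.* (length (replicate m false) ℕ.+ n ℕ.+ 1)
  time≤ = subst (λ l → m ℕ.+ 1 ℕ.≤ 6 ℕ.* (l ℕ.+ n ℕ.+ 1)) (sym (LP.length-replicate m)) (time-zeros m n)

approximates-zeros++1∷ : ∀ i b n → ApproximatesWithin 6 (replicate i false ++ true ∷ b) n
approximates-zeros++1∷ i b n with reachEmit i b n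
... | pc , ready = ρ , haltsWriting⇒haltsWithin σ′ _ (prepTime i (length b) ℕ.+ suc (suc n)) ρ time≤ halts , approx
  where
  σ′ = pairInput (replicate i false ++ true ∷ b) n
  w = replicate (leadingZeros i) false ++ false ∷ tentMapPrefix b
  c = tentMapRepeat b
  e = emitConfig sweepRight (onesHeadRight (i +′ 0)) (onesHeadAt (i +′ 0) 0) (tailZipper b pc)
  ρ = emitted (suc n) e
  position≡ : sucⁿ (suc n) (+ 0) ≡ + length ρ
  position≡ = trans (sucⁿ-+ (suc n) 0) (cong +_ (trans (ℕP.+-identityʳ (suc n)) (sym (length-emitted (suc n) e))))
  halts : HaltsWriting (zrun (prepTime i (length b) ℕ.+ suc (suc n)) (zinitial σ′)) (zipper (map bitSym ρ ʳ++ []) ␣ [] (+ length ρ))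
  halts = subst₂ HaltsWriting (sym (zrun-+ (prepTime i (length b)) (suc (suc n)) (zinitial σ′))) (cong (zipper _ ␣ []) position≡)
                 (ready⇒haltsWriting n (zrun (prepTime i (length b)) (zinitial σ′)) e ready)
  time≤ : prepTime i (length b) ℕ.+ suc (suc n) ℕ.≤ 6 ℕ.* (length (replicate i false ++ true ∷ b) ℕ.+ n ℕ.+ 1)
  time≤ = subst (λ l → prepTime i (length b) ℕ.+ suc (suc n) ℕ.≤ 6 ℕ.* (l ℕ.+ n ℕ.+ 1))
                (sym (length-zeros++1∷ i b)) (time-zeros++1∷ i (length b) n)
  ρ≡ : ρ ≡ expansionPrefix (suc n) w c
  ρ≡ = trans (emitted≡expansionPrefix (i +′ 0) b pc (suc n))
             (cong (λ K → expansionPrefix (suc n) (replicate (leadingZeros K) false ++ false ∷ tentMapPrefix b) c)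
                   (trans (+′≡+ i 0) (ℕP.+-identityʳ i)))
  approx : ∣ bar ρ - tents (bar (replicate i false ++ true ∷ b)) ∣ < pow2inv n
  approx = subst₂ (λ u v → ∣ bar u - v ∣ < pow2inv n) (sym ρ≡) (sym (tents-zeros++1∷ i b)) (expansionPrefix-approx n w c)

tents-linearTime : LinearTimeComputable tents
tents-linearTime = machine , 6 , approximates
  where
  approximates : ∀ σ n → ApproximatesWithin 6 σ n
  approximates σ n with zeros⊎zeros++1∷ σ
  ... | inj₁ (m , refl)     = approximates-zeros m n
  ... | inj₂ (i , b , refl) = approximates-zeros++1∷ i b n

-- No pointwise linear-time algorithm

enc-nonBlank : ∀ {g} τ → All (_≢ blank {g}) (enc τ)
enc-nonBlank []          = []
enc-nonBlank (false ∷ τ) = (λ ()) ∷ enc-nonBlank τ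
enc-nonBlank (true ∷ τ)  = (λ ()) ∷ enc-nonBlank τ

length-output : ∀ {g} (τ η : List Bool) → length (enc {g} τ ++ sep ∷ enc η) ≡ length τ ℕ.+ suc (length η)
length-output τ η = trans (LP.length-++ (enc τ)) (cong₂ (λ a b → a ℕ.+ suc b) (LP.length-map _ τ) (LP.length-map _ η))

tents-zeros++11 : ∀ i → tents (bar (replicate i false ++ true ∷ true ∷ [])) ≡ pow2inv (leadingZeros i ℕ.+ 1)
tents-zeros++11 i = trans (tents-zeros++1∷ i (true ∷ []))
  (trans (expansionValue-zeros++ (leadingZeros i) (false ∷ []) true) (sym (pow2inv-+ (leadingZeros i) 1)))

-- At 0ⁱ11 the exact value 2^-(i² + i + 2) needs a quadratic number of output
-- cells, but a machine running in time c (i + 3) writes at most that many.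
tents-notPointwise : ¬ PointwiseLinearTimeComputable tents
tents-notPointwise (M , c , compute) =
  ℕP.<-irrefl refl (ℕP.<-≤-trans (ℕP.m<m+n (c ℕ.* (i ℕ.+ 2 ℕ.+ 1)) (s≤s z≤n)) chain)
  where
  open ℕP.≤-Reasoning
  i = c ℕ.+ 4
  σ = replicate i false ++ true ∷ true ∷ []
  τ = proj₁ (compute σ)
  η = proj₁ (proj₂ (compute σ))
  halts = proj₁ (proj₂ (proj₂ (compute σ)))
  represents = proj₂ (proj₂ (proj₂ (compute σ)))
  arith : ∀ c → (c ℕ.+ 4) ℕ.* suc (c ℕ.+ 4) ℕ.+ 1 ℕ.+ 1 ≡ c ℕ.* (c ℕ.+ 4 ℕ.+ 2 ℕ.+ 1) ℕ.+ suc (2 ℕ.* c ℕ.+ 21)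
  arith = solve-∀
  chain = begin
    c ℕ.* (i ℕ.+ 2 ℕ.+ 1) ℕ.+ suc (2 ℕ.* c ℕ.+ 21)
      ≡⟨ arith c ⟨
    leadingZeros i ℕ.+ 1
      ≤⟨ Represents-pow2inv⇒≤length τ η _ (subst (Represents τ η) (tents-zeros++11 i) represents) ⟩
    length τ
      ≤⟨ ℕP.m≤m+n (length τ) (suc (length η)) ⟩
    length τ ℕ.+ suc (length η)
      ≡⟨ length-output τ η ⟨
    length (enc {TM.g M} τ ++ sep ∷ enc η)
      ≤⟨ haltsWithin-length≤ M (enc σ) _ _ (++⁺ (enc-nonBlank τ) ((λ ()) ∷ enc-nonBlank η)) halts ⟩
    c ℕ.* (length σ ℕ.+ 1)
      ≡⟨ cong (λ l → c ℕ.* (l ℕ.+ 1)) (length-zeros++1∷ i (true ∷ [])) ⟩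
    c ℕ.* (i ℕ.+ 2 ℕ.+ 1) ∎

proposition2p13 : Σ (ℚ → ℚ) λ f →
    MapsUnitToUnit f × LipschitzOn01 f × LinearTimeComputable f ×
    ¬ PointwiseLinearTimeComputable f
proposition2p13 = tents , (λ x _ → tents-In01 x) , tents-lipschitz , tents-linearTime , tents-notPointwise
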